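{- Let $c\equiv 2\pmod 4$ be a positive integer, put $c_1=c/2$ (an odd positive integer), and let $n$ be an integer. Define $$\Theta_4(c,n)=\epsilon_{c_1}\sum_{\substack{a\bmod c\\(a,c)=1}}\left(\frac{8a}{c_1}\right)e\!\left(\frac{ -\overline{8a}_{c_1}\,n}{c_1}\right),\qquad \Theta_5(c,n)=\bar{\epsilon}_{c_1}\sum_{\substack{a\bmod c\\(a,c)=1}}\left(\frac{ -2\overline{a}_{c_1}}{c_1}\right)e\!\left(\frac{ -\overline{2a}_{c_1}\,n}{c_1}\right),$$ and for odd positive $k$, $$\Theta_1(k,n)=\bar{\epsilon}_{k}\sum_{\substack{a\bmod k\\(a,k)=1}}\left(\frac{a}{k}\right)e\!\left(\frac{an}{k}\right).$$ Then $\Theta_4(c,n)=\Theta_5(c,n)=\Theta_1(c/2,n)$.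
   Context: $e(x)=e^{2\pi i x}$. For an odd positive integer $d$, $\left(\frac{\cdot}{d}\right)$ is the Jacobi symbol, $\epsilon_d=1$ if $d\equiv 1\pmod 4$ and $\epsilon_d=i$ if $d\equiv -1\pmod 4$, and $\bar\epsilon_d$ is its complex conjugate. For $a$ coprime to $q$, $\overline{a}_q$ denotes an integer with $a\overline{a}_q\equiv 1\pmod q$ (and $\overline{8a}_{q}$, $\overline{2a}_q$ are inverses of $8a$, $2a$ modulo $q$). -}

module Defs where

open import Level using (Level)
open import Data.Bool using (Bool; true; false; if_then_else_)
open import Data.Nat as ℕ using (ℕ; zero; suc; _≡ᵇ_)
open import Data.Nat.GCD using (gcd)
open import Data.Nat.Primality.Factorisation using (factorise; PrimeFactorisation)
open import Data.Integer as ℤ using (ℤ; +_; -[1+_]; _%ℕ_)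
open import Data.List using (List; []; _∷_; foldr; map; upTo)
open import Algebra.Bundles using (CommutativeRing)

-- Residues modulo q (q > 0 in all uses; q = 0 gives a dummy value)

modℤ : ℤ → ℕ → ℕ
modℤ x zero    = 0
modℤ x (suc q) = x %ℕ suc q

-- For q ≥ 2 and gcd(a,q)=1 this is an inverse of a modulo q; for q = 1
-- every integer is an inverse of a modulo 1, and 0 is returned.
findInv : ℤ → ℕ → List ℕ → ℕ
findInv a q []       = 0
findInv a q (x ∷ xs) = if modℤ (a ℤ.* + x) q ≡ᵇ 1 then x else findInv a q xs

invMod : ℤ → ℕ → ℕ
invMod a q = findInv a q (upTo q)

isSqMod : ℤ → ℕ → Bool
isSqMod a p = foldr (λ x b → if modℤ (+ x ℤ.* + x ℤ.- a) p ≡ᵇ 0 then true else b)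
                    false (upTo p)

legendre : ℤ → ℕ → ℤ
legendre a p =
  if modℤ a p ≡ᵇ 0 then + 0 else (if isSqMod a p then + 1 else ℤ.- (+ 1))

-- Jacobi symbol (a/d) = ∏ (a/p) over the prime factorisation of d
-- (with multiplicity).  Meaningful for d odd positive; (a/0) := 1 (unused).
jacobi : ℤ → ℕ → ℤ
jacobi a zero    = + 1
jacobi a (suc d) =
  foldr (λ p r → legendre a p ℤ.* r) (+ 1)
        (PrimeFactorisation.factors (factorise (suc d)))

-- The sums Θ₁, Θ₄, Θ₅, evaluated in a commutative ring R containing an
-- element i with i² = -1 and an element ζ playing the role of e(1/c₁)
-- (so e(x/c₁) := ζ^(x mod c₁)).

module Theta {a ℓ : Level} (R : CommutativeRing a ℓ) where
  open CommutativeRing R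

  natR : ℕ → Carrier
  natR zero    = 0#
  natR (suc n) = 1# + natR n

  fromℤ : ℤ → Carrier
  fromℤ (+ n)    = natR n
  fromℤ -[1+ n ] = - natR (suc n)

  pow : Carrier → ℕ → Carrier
  pow x zero    = 1#
  pow x (suc n) = x * pow x n

  sumCoprime : ℕ → (ℕ → Carrier) → Carrier
  sumCoprime m f = foldr (λ x s → if gcd x m ≡ᵇ 1 then f x + s else s) 0# (upTo m)

  module _ (i ζ : Carrier) where

    e : ℤ → ℕ → Carrier
    e x q = pow ζ (modℤ x q)

    ε : ℕ → Carrier
    ε d = if ℕ._%_ d 4 ≡ᵇ 1 then 1# else i

    ε̄ : ℕ → Carrier
    ε̄ d = if ℕ._%_ d 4 ≡ᵇ 1 then 1# else - i

    Θ₁ : ℕ → ℤ → Carrier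
    Θ₁ k n = ε̄ k * sumCoprime k (λ a →
               fromℤ (jacobi (+ a) k) * e (+ a ℤ.* n) k)

    Θ₄ : ℕ → ℤ → Carrier
    Θ₄ c n = ε c₁ * sumCoprime c (λ a →
               fromℤ (jacobi (+ 8 ℤ.* + a) c₁)
               * e (ℤ.- (+ invMod (+ 8 ℤ.* + a) c₁) ℤ.* n) c₁)
      where c₁ = ℕ._/_ c 2

    Θ₅ : ℕ → ℤ → Carrier
    Θ₅ c n = ε̄ c₁ * sumCoprime c (λ a →
               fromℤ (jacobi (ℤ.- (+ 2) ℤ.* + invMod (+ a) c₁) c₁)
               * e (ℤ.- (+ invMod (+ 2 ℤ.* + a) c₁) ℤ.* n) c₁)
      where c₁ = ℕ._/_ c 2

module Submission where

-- Write c = 2q with q odd. Every summand depends on a only mod q, and of a and q + a exactly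
-- one is coprime to c, so each sum over units mod c becomes a sum over units mod q.
-- Substituting t = -(2a)⁻¹ in Θ₅ and t = -(8a)⁻¹ in Θ₄ turns both into Σ_t (t/q) e(tn/q):
-- (-2a⁻¹/q) = (2²t/q) = (t/q), while (8a/q) = (-t⁻¹/q) = (-1/q)(t/q) and ε_q (-1/q) = ε̄_q.
-- The Jacobi symbol facts used (invariance under congruences and unit square factors, and
-- (-x/q) = (-1)^((q-1)/2) (x/q)) reduce to primes p through the factorisation of q.  There,
-- (-x/p) = (-1)^((p-1)/2) (x/p) is proved by counting: there are exactly (p-1)/2 nonzero squares
-- mod p, and pairing them by x ↦ -x or x ↦ x⁻¹ shows that -1 is a square iff p ≡ 1 mod 4.

open import Defs
open import Level using (Level)
open import Data.Nat using (ℕ; _%_; _/_)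
open import Data.Integer using (ℤ)
open import Data.Product using (_×_; _,_)
open import Relation.Binary.PropositionalEquality using (_≡_)
open import Algebra.Bundles using (CommutativeRing; CommutativeMonoid)
open import Data.Nat.Primality using (Prime)
import Data.Nat as Nat
import Data.Nat.Properties as Nat
open import Data.Nat.DivMod using (m≡m%n+[m/n]*n; m*n/n≡m)
import Data.Nat.Tactic.RingSolver as Nat-Solver
import Relation.Binary.PropositionalEquality as P

module Booleans where

  open import Data.Nat using (ℕ; zero; suc; _<_; _≡ᵇ_; _<ᵇ_)
  import Data.Nat.Properties as ℕ
  open import Data.Bool using (Bool; true; false; T)
  open import Data.Unit using (tt)
  open import Data.Empty using (⊥-elim)
  open import Relation.Nullary using (¬_)
  open import Relation.Binary.PropositionalEquality using (_≡_; _≢_; refl; sym; subst)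

  ≡true⇔⇒≡ : ∀ {a b : Bool} → (a ≡ true → b ≡ true) → (b ≡ true → a ≡ true) → a ≡ b
  ≡true⇔⇒≡ {true}           a⇒b _   = sym (a⇒b refl)
  ≡true⇔⇒≡ {false} {true}  _   b⇒a = b⇒a refl
  ≡true⇔⇒≡ {false} {false} _   _   = refl

  ≡ᵇ-true : ∀ {m n} → m ≡ n → (m ≡ᵇ n) ≡ true
  ≡ᵇ-true {zero}  refl = refl
  ≡ᵇ-true {suc m} refl = ≡ᵇ-true {m} refl

  ≡ᵇ-sound : ∀ m n → (m ≡ᵇ n) ≡ true → m ≡ n
  ≡ᵇ-sound m n e = ℕ.≡ᵇ⇒≡ m n (subst T (sym e) tt)

  ≡ᵇ-false : ∀ {m n} → m ≢ n → (m ≡ᵇ n) ≡ false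
  ≡ᵇ-false {m} {n} m≢n with m ≡ᵇ n in e
  ... | true  = ⊥-elim (m≢n (≡ᵇ-sound m n e))
  ... | false = refl

  <ᵇ-sound : ∀ m n → (m <ᵇ n) ≡ true → m < n
  <ᵇ-sound m n e = ℕ.<ᵇ⇒< m n (subst T (sym e) tt)

  <ᵇ-false : ∀ m n → (m <ᵇ n) ≡ false → ¬ m < n
  <ᵇ-false m n e m<n = subst T e (ℕ.<⇒<ᵇ m<n)

module Parity where

  open import Data.Nat as ℕ using (ℕ; zero; suc; _+_; _*_)
  import Data.Nat.Properties as ℕ
  open import Data.Nat.Divisibility using (_∣_; divides; ∣-trans)
  open import Data.Product using (∃; _,_)
  open import Data.Sum using (_⊎_; inj₁; inj₂)
  open import Data.Empty using (⊥-elim)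
  open import Relation.Nullary using (¬_)
  open import Relation.Binary.PropositionalEquality using (_≡_; _≢_; refl; sym; trans; cong)
  open import Relation.Binary.Definitions using (tri<; tri≈; tri>)

  even≢odd : ∀ x k → x + x ≢ suc (k + k)
  even≢odd zero    k ()
  even≢odd (suc x) k e with trans (sym (ℕ.+-suc x x)) (ℕ.suc-injective e)
  even≢odd (suc x) zero    e | ()
  even≢odd (suc x) (suc k) e | e′ = even≢odd x k (trans (ℕ.suc-injective e′) (ℕ.+-suc k k))

  even-or-odd : ∀ n → ∃ λ h → n ≡ h + h ⊎ n ≡ suc (h + h)
  even-or-odd zero = 0 , inj₁ refl
  even-or-odd (suc n) with even-or-odd n
  ... | h , inj₁ refl = h , inj₂ refl
  ... | h , inj₂ refl = suc h , inj₁ (cong suc (sym (ℕ.+-suc h h)))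

  double-injective : ∀ {a b} → a + a ≡ b + b → a ≡ b
  double-injective {a} {b} e with ℕ.<-cmp a b
  ... | tri< a<b _ _ = ⊥-elim (ℕ.<-irrefl e (ℕ.+-mono-< a<b a<b))
  ... | tri≈ _ a≡b _ = a≡b
  ... | tri> _ _ b<a = ⊥-elim (ℕ.<-irrefl (sym e) (ℕ.+-mono-< b<a b<a))

  double≡2* : ∀ h → h + h ≡ 2 * h
  double≡2* h = cong (h +_) (sym (ℕ.+-identityʳ h))

  2∤odd : ∀ k → ¬ 2 ∣ suc (k + k)
  2∤odd k (divides c eq) = even≢odd c k (trans (trans (double≡2* c) (ℕ.*-comm 2 c)) (sym eq))

  divisor-of-odd : ∀ {p k} → p ∣ suc (k + k) → ∃ λ h → p ≡ suc (h + h)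
  divisor-of-odd {p} {k} p∣odd with even-or-odd p
  ... | h , inj₂ p≡odd = h , p≡odd
  ... | h , inj₁ refl  = ⊥-elim (2∤odd k (∣-trans (divides h (trans (double≡2* h) (ℕ.*-comm 2 h))) p∣odd))

module Congruence where

  open import Data.Nat as ℕ using (ℕ; zero; suc; _<_)
  import Data.Nat.Properties as ℕ
  import Data.Nat.Divisibility as ℕ
  open import Data.Nat.Coprimality using (Coprime; coprime-Bézout)
  open import Data.Nat.GCD using (module Bézout)
  open import Data.Integer using (ℤ; +_; _+_; _*_; -_; _-_; _⊖_; ∣_∣; _%ℕ_; _/ℕ_)
  import Data.Integer.Properties as ℤ
  open import Data.Integer.Divisibility.Signed
    using (_∣_; divides; ∣ᵤ⇒∣; ∣⇒∣ᵤ; ∣-trans; ∣m⇒∣-m; ∣m∣n⇒∣m+n; ∣m∣n⇒∣m-n; ∣n⇒∣m*n; ∣m⇒∣m*n)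
  open import Data.Integer.DivMod using (a≡a%ℕn+[a/ℕn]*n; n%ℕd<d)
  open import Data.Integer.Tactic.RingSolver using (solve-∀)
  open import Data.Bool using (true; false; T)
  open import Data.List using ([]; _∷_; upTo)
  open import Data.List.Relation.Unary.Any using (Any; here; there)
  open import Data.List.Membership.Propositional using (_∈_)
  open import Data.List.Membership.Propositional.Properties using (∈-upTo⁺; ∈-upTo⁻)
  open import Data.Product using (∃; _,_)
  open import Data.Unit using (tt)
  open import Relation.Binary.Bundles using (Setoid)
  open import Relation.Binary.PropositionalEquality
    using (_≡_; refl; sym; trans; cong; subst; module ≡-Reasoning)
  open import Relation.Nullary using (yes; no)
  open import Data.Empty using (⊥-elim)
  open import Defs using (modℤ; findInv; invMod)

  infix 4 _≡_[mod_]

  record _≡_[mod_] (x y : ℤ) (q : ℕ) : Set where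
    constructor mod-divides
    field divides-difference : + q ∣ x - y
  open _≡_[mod_] public

  private
    divides-by : ∀ {k z z′} → z ≡ z′ → k ∣ z → k ∣ z′
    divides-by refl d = d

  ≡[mod]-reflexive : ∀ {x y q} → x ≡ y → x ≡ y [mod q ]
  ≡[mod]-reflexive {x} {q = q} refl =
    mod-divides (divides (+ 0) (trans (ℤ.+-inverseʳ x) (sym (ℤ.*-zeroˡ (+ q)))))

  ≡[mod]-refl : ∀ {x q} → x ≡ x [mod q ]
  ≡[mod]-refl = ≡[mod]-reflexive refl

  ≡[mod]-sym : ∀ {x y q} → x ≡ y [mod q ] → y ≡ x [mod q ]
  ≡[mod]-sym {x} {y} (mod-divides d) = mod-divides (divides-by (lemma x y) (∣m⇒∣-m d))
    where lemma : ∀ x y → - (x - y) ≡ y - x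
          lemma = solve-∀

  ≡[mod]-trans : ∀ {x y z q} → x ≡ y [mod q ] → y ≡ z [mod q ] → x ≡ z [mod q ]
  ≡[mod]-trans {x} {y} {z} (mod-divides d) (mod-divides e) =
    mod-divides (divides-by (lemma x y z) (∣m∣n⇒∣m+n d e))
    where lemma : ∀ x y z → (x - y) + (y - z) ≡ x - z
          lemma = solve-∀

  ≡[mod]-setoid : ℕ → Setoid _ _
  ≡[mod]-setoid q = record
    { Carrier = ℤ
    ; _≈_ = λ x y → x ≡ y [mod q ]
    ; isEquivalence = record { refl = ≡[mod]-refl ; sym = ≡[mod]-sym ; trans = ≡[mod]-trans }
    }

  module ≡[mod]-Reasoning (q : ℕ) where
    open import Relation.Binary.Reasoning.Setoid (≡[mod]-setoid q) public

  +-cong[mod] : ∀ {x x′ y y′ q} → x ≡ x′ [mod q ] → y ≡ y′ [mod q ] → x + y ≡ x′ + y′ [mod q ]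
  +-cong[mod] {x} {x′} {y} {y′} (mod-divides d) (mod-divides e) =
    mod-divides (divides-by (lemma x x′ y y′) (∣m∣n⇒∣m+n d e))
    where lemma : ∀ x x′ y y′ → (x - x′) + (y - y′) ≡ (x + y) - (x′ + y′)
          lemma = solve-∀

  *-cong[mod] : ∀ {x x′ y y′ q} → x ≡ x′ [mod q ] → y ≡ y′ [mod q ] → x * y ≡ x′ * y′ [mod q ]
  *-cong[mod] {x} {x′} {y} {y′} (mod-divides d) (mod-divides e) =
    mod-divides (divides-by (lemma x x′ y y′) (∣m∣n⇒∣m+n (∣n⇒∣m*n x e) (∣m⇒∣m*n y′ d)))
    where lemma : ∀ x x′ y y′ → x * (y - y′) + (x - x′) * y′ ≡ x * y - x′ * y′
          lemma = solve-∀

  *-congˡ[mod] : ∀ {x y q} z → x ≡ y [mod q ] → z * x ≡ z * y [mod q ]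
  *-congˡ[mod] z = *-cong[mod] (≡[mod]-refl {z})

  *-congʳ[mod] : ∀ {x y q} z → x ≡ y [mod q ] → x * z ≡ y * z [mod q ]
  *-congʳ[mod] z e = *-cong[mod] e (≡[mod]-refl {z})

  -‿cong[mod] : ∀ {x y q} → x ≡ y [mod q ] → - x ≡ - y [mod q ]
  -‿cong[mod] {x} {y} (mod-divides d) = mod-divides (divides-by (lemma x y) (∣m⇒∣-m d))
    where lemma : ∀ x y → - (x - y) ≡ - x - - y
          lemma = solve-∀

  ≡[mod]-divisor : ∀ {x y p q} → p ℕ.∣ q → x ≡ y [mod q ] → x ≡ y [mod p ]
  ≡[mod]-divisor p∣q (mod-divides d) = mod-divides (∣-trans (∣ᵤ⇒∣ p∣q) d)

  +-multiple[mod] : ∀ x k q → x + k * + q ≡ x [mod q ]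
  +-multiple[mod] x k q = mod-divides (divides k (lemma x k (+ q)))
    where lemma : ∀ x k q → x + k * q - x ≡ k * q
          lemma = solve-∀

  ≡[mod]-1 : ∀ x y → x ≡ y [mod 1 ]
  ≡[mod]-1 x y = mod-divides (divides (x - y) (sym (ℤ.*-identityʳ (x - y))))

  modℤ-≡[mod] : ∀ x d → + modℤ x (suc d) ≡ x [mod suc d ]
  modℤ-≡[mod] x d = mod-divides (divides (- k)
      (trans (cong (λ z → + r - z) (a≡a%ℕn+[a/ℕn]*n x (suc d))) (lemma (+ r) k (+ suc d))))
    where
      r = x %ℕ suc d
      k = x /ℕ suc d
      lemma : ∀ r k q → r - (r + k * q) ≡ - k * q
      lemma = solve-∀

  modℤ-< : ∀ x d → modℤ x (suc d) < suc d
  modℤ-< x d = n%ℕd<d x (suc d)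

  multiple-below-modulus : ∀ {m q} → m < q → q ℕ.∣ m → m ≡ 0
  multiple-below-modulus {zero} _ _ = refl
  multiple-below-modulus {suc m} m<q q∣m = ⊥-elim (ℕ.>⇒∤ m<q q∣m)

  residues-unique : ∀ {r s q} → r < q → s < q → + r ≡ + s [mod q ] → r ≡ s
  residues-unique {r} {s} {q} r<q s<q (mod-divides d) =
    ℤ.+-injective (trans (sym (lemma (+ r) (+ s))) (cong (_+ + s) r-s≡0))
    where
      |r⊖s|<q : ∣ r ⊖ s ∣ < q
      |r⊖s|<q with r ℕ.≤? s
      ... | yes r≤s = subst (_< q) (sym (ℤ.∣⊖∣-≤ r≤s)) (ℕ.≤-<-trans (ℕ.m∸n≤m s r) s<q)
      ... | no r≰s = subst (_< q) (trans (sym (ℤ.∣⊖∣-≤ (ℕ.<⇒≤ (ℕ.≰⇒> r≰s)))) (ℤ.∣m⊖n∣≡∣n⊖m∣ s r))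
                            (ℕ.≤-<-trans (ℕ.m∸n≤m r s) r<q)
      r-s≡0 : + r - + s ≡ + 0
      r-s≡0 = trans (ℤ.m-n≡m⊖n r s) (ℤ.∣i∣≡0⇒i≡0 (multiple-below-modulus |r⊖s|<q
                (subst (λ z → q ℕ.∣ ∣ z ∣) (ℤ.m-n≡m⊖n r s) (∣⇒∣ᵤ d))))
      lemma : ∀ a b → (a - b) + b ≡ a
      lemma = solve-∀

  modℤ-cong : ∀ {x y d} → x ≡ y [mod suc d ] → modℤ x (suc d) ≡ modℤ y (suc d)
  modℤ-cong {x} {y} {d} x≡y = residues-unique (modℤ-< x d) (modℤ-< y d)
    (≡[mod]-trans (modℤ-≡[mod] x d) (≡[mod]-trans x≡y (≡[mod]-sym (modℤ-≡[mod] y d))))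

  modℤ-cong⁻¹ : ∀ {x y d} → modℤ x (suc d) ≡ modℤ y (suc d) → x ≡ y [mod suc d ]
  modℤ-cong⁻¹ {x} {y} {d} eq = ≡[mod]-trans (≡[mod]-sym (modℤ-≡[mod] x d))
    (subst (λ r → + r ≡ y [mod suc d ]) (sym eq) (modℤ-≡[mod] y d))

  modℤ-residue : ∀ {r d} → r < suc d → modℤ (+ r) (suc d) ≡ r
  modℤ-residue {r} {d} r<q = residues-unique (modℤ-< (+ r) d) r<q (modℤ-≡[mod] (+ r) d)

  IsUnit : ℕ → ℤ → Set
  IsUnit q x = ∃ λ y → x * y ≡ + 1 [mod q ]

  coprime⇒IsUnit : ∀ {b q} → Coprime b q → IsUnit q (+ b)
  coprime⇒IsUnit {b} {q} c with coprime-Bézout c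
  ... | Bézout.+- x y eq = + x , mod-divides (divides (+ y) (lemma (+ b) (+ x) (+ y) (+ q) eqℤ))
    where
      eqℤ : + 1 + + y * + q ≡ + x * + b
      eqℤ = trans (cong (λ z → + 1 + z) (sym (ℤ.pos-* y q)))
                  (trans (sym (ℤ.pos-+ 1 (y ℕ.* q))) (trans (cong +_ eq) (ℤ.pos-* x b)))
      lemma : ∀ b x y q → + 1 + y * q ≡ x * b → b * x - + 1 ≡ y * q
      lemma b x y q e = trans (cong (_- + 1) (trans (ℤ.*-comm b x) (sym e))) (cancel y q)
        where cancel : ∀ y q → + 1 + y * q - + 1 ≡ y * q
              cancel = solve-∀
  ... | Bézout.-+ x y eq = - + x , mod-divides (divides (- + y) (lemma (+ b) (+ x) (+ y) (+ q) eqℤ))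
    where
      eqℤ : + 1 + + x * + b ≡ + y * + q
      eqℤ = trans (cong (λ z → + 1 + z) (sym (ℤ.pos-* x b)))
                  (trans (sym (ℤ.pos-+ 1 (x ℕ.* b))) (trans (cong +_ eq) (ℤ.pos-* y q)))
      lemma : ∀ b x y q → + 1 + x * b ≡ y * q → b * - x - + 1 ≡ - y * q
      lemma b x y q e = trans (rearrange x b) (trans (cong -_ e) (ℤ.neg-distribˡ-* y q))
        where rearrange : ∀ x b → b * - x - + 1 ≡ - (+ 1 + x * b)
              rearrange = solve-∀

  IsUnit⇒coprime : ∀ {b q} → IsUnit q (+ b) → Coprime b q
  IsUnit⇒coprime {b} {q} (y , mod-divides (divides k eq)) {i} (i∣b , i∣q) =
    ℕ.∣1⇒≡1 (∣⇒∣ᵤ (divides-by (lemma (+ b) y k (+ q) eq)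
      (∣m∣n⇒∣m-n (∣m⇒∣m*n {+ i} {+ b} y (∣ᵤ⇒∣ i∣b)) (∣n⇒∣m*n {+ i} k {+ q} (∣ᵤ⇒∣ i∣q)))))
    where lemma : ∀ b y k q → b * y - + 1 ≡ k * q → b * y - k * q ≡ + 1
          lemma b y k q e = trans (cong (λ z → b * y - z) (sym e)) (cancel b y)
            where cancel : ∀ b y → b * y - (b * y - + 1) ≡ + 1
                  cancel = solve-∀

  IsUnit-* : ∀ {q x y} → IsUnit q x → IsUnit q y → IsUnit q (x * y)
  IsUnit-* {x = x} {y} (u , xu≡1) (v , yv≡1) =
    u * v , ≡[mod]-trans (≡[mod]-reflexive (lemma x y u v)) (*-cong[mod] xu≡1 yv≡1)
    where lemma : ∀ x y u v → x * y * (u * v) ≡ (x * u) * (y * v)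
          lemma = solve-∀

  IsUnit-resp : ∀ {q x x′} → x ≡ x′ [mod q ] → IsUnit q x → IsUnit q x′
  IsUnit-resp x≡x′ (u , xu≡1) = u , ≡[mod]-trans (*-congʳ[mod] u (≡[mod]-sym x≡x′)) xu≡1

  IsUnit-divisor : ∀ {p q x} → p ℕ.∣ q → IsUnit q x → IsUnit p x
  IsUnit-divisor p∣q (u , xu≡1) = u , ≡[mod]-divisor p∣q xu≡1

  IsUnit-neg : ∀ {q x} → IsUnit q x → IsUnit q (- x)
  IsUnit-neg {x = x} (u , xu≡1) = - u , ≡[mod]-trans (≡[mod]-reflexive (lemma x u)) xu≡1
    where lemma : ∀ x u → - x * - u ≡ x * u
          lemma = solve-∀

  IsUnit-inverse : ∀ {q x y} → x * y ≡ + 1 [mod q ] → IsUnit q y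
  IsUnit-inverse {x = x} {y} xy≡1 = x , ≡[mod]-trans (≡[mod]-reflexive (ℤ.*-comm y x)) xy≡1

  inverse-unique : ∀ {q x y z} → x * y ≡ + 1 [mod q ] → x * z ≡ + 1 [mod q ] → y ≡ z [mod q ]
  inverse-unique {q} {x} {y} {z} xy≡1 xz≡1 = begin
    y               ≡⟨ sym (ℤ.*-identityʳ y) ⟩
    y * + 1         ≈⟨ *-congˡ[mod] y (≡[mod]-sym xz≡1) ⟩
    y * (x * z)     ≡⟨ lemma x y z ⟩
    x * y * z       ≈⟨ *-congʳ[mod] z xy≡1 ⟩
    + 1 * z         ≡⟨ ℤ.*-identityˡ z ⟩
    z               ∎
    where
      open ≡[mod]-Reasoning q
      lemma : ∀ x y z → y * (x * z) ≡ x * y * z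
      lemma = solve-∀

  2-isUnit-odd : ∀ k → IsUnit (suc (k ℕ.+ k)) (+ 2)
  2-isUnit-odd k = + suc k , mod-divides (divides (+ 1) (trans (lemma (+ k)) (cong (λ z → + 1 * z) odd≡)))
    where
      lemma : ∀ k → + 2 * (+ 1 + k) - + 1 ≡ + 1 * (+ 1 + + 2 * k)
      lemma = solve-∀
      odd≡ : + 1 + + 2 * + k ≡ + suc (k ℕ.+ k)
      odd≡ = trans (cong (λ z → + 1 + z) (sym (ℤ.pos-* 2 k)))
                   (trans (sym (ℤ.pos-+ 1 (2 ℕ.* k))) (cong (λ m → + suc m) (cong (k ℕ.+_) (ℕ.+-identityʳ k))))

  private
    Solves : ℤ → ℕ → ℕ → Set
    Solves a q x = T (modℤ (a * + x) q ℕ.≡ᵇ 1)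

    findInv-solves : ∀ a q L → Any (Solves a q) L → Solves a q (findInv a q L)
    findInv-solves a q (x ∷ xs) h with modℤ (a * + x) q ℕ.≡ᵇ 1 in eq
    ... | true = subst T (sym eq) tt
    ... | false with h
    ...   | here t = ⊥-elim (subst T eq t)
    ...   | there h′ = findInv-solves a q xs h′

    findInv-< : ∀ a q L → 0 < q → (∀ {x} → x ∈ L → x < q) → findInv a q L < q
    findInv-< a q [] 0<q _ = 0<q
    findInv-< a q (x ∷ xs) 0<q L<q with modℤ (a * + x) q ℕ.≡ᵇ 1
    ... | true = L<q (here refl)
    ... | false = findInv-< a q xs 0<q (λ x∈xs → L<q (there x∈xs))

    findInv-cong : ∀ a a′ q L → (∀ x → modℤ (a * + x) q ≡ modℤ (a′ * + x) q) →
                   findInv a q L ≡ findInv a′ q L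
    findInv-cong a a′ q [] _ = refl
    findInv-cong a a′ q (x ∷ xs) same rewrite same x with modℤ (a′ * + x) q ℕ.≡ᵇ 1
    ... | true = refl
    ... | false = findInv-cong a a′ q xs same

  invMod-< : ∀ a d → invMod a (suc d) < suc d
  invMod-< a d = findInv-< a (suc d) (upTo (suc d)) ℕ.z<s ∈-upTo⁻

  invMod-inverse : ∀ {a d} → IsUnit (suc d) a → a * + invMod a (suc d) ≡ + 1 [mod suc d ]
  invMod-inverse {a} {zero} _ = ≡[mod]-1 _ _
  invMod-inverse {a} {suc d} (y , ay≡1) =
    modℤ-cong⁻¹ (trans (ℕ.≡ᵇ⇒≡ _ 1 (findInv-solves a q (upTo q) (solution∈ (∈-upTo⁺ (modℤ-< y (suc d))))))
                       (sym (modℤ-residue {1} {suc d} (ℕ.s<s ℕ.z<s))))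
    where
      q = suc (suc d)
      r = modℤ y q
      r-solves : Solves a q r
      r-solves = ℕ.≡⇒≡ᵇ _ 1 (trans (modℤ-cong (≡[mod]-trans (*-congˡ[mod] a (modℤ-≡[mod] y (suc d))) ay≡1))
                                   (modℤ-residue {1} {suc d} (ℕ.s<s ℕ.z<s)))
      solution∈ : ∀ {L} → r ∈ L → Any (Solves a q) L
      solution∈ (here refl) = here r-solves
      solution∈ (there r∈L) = there (solution∈ r∈L)

  invMod-cong : ∀ {a a′ q} → a ≡ a′ [mod q ] → invMod a q ≡ invMod a′ q
  invMod-cong {a} {a′} {zero} _ = refl
  invMod-cong {a} {a′} {suc d} a≡a′ =
    findInv-cong a a′ (suc d) (upTo (suc d)) (λ x → modℤ-cong (*-congʳ[mod] (+ x) a≡a′))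

  ∸-≡[mod]-neg : ∀ {r q} → r ℕ.≤ q → + (q ℕ.∸ r) ≡ - + r [mod q ]
  ∸-≡[mod]-neg {r} {q} r≤q = mod-divides (divides (+ 1) (begin
    + (q ℕ.∸ r) - - + r      ≡⟨ cong (λ z → + (q ℕ.∸ r) + z) (ℤ.neg-involutive (+ r)) ⟩
    + (q ℕ.∸ r) + + r        ≡⟨ sym (ℤ.pos-+ (q ℕ.∸ r) r) ⟩
    + (q ℕ.∸ r ℕ.+ r)        ≡⟨ cong +_ (ℕ.m∸n+n≡m r≤q) ⟩
    + q                      ≡⟨ sym (ℤ.*-identityˡ (+ q)) ⟩
    + 1 * + q                ∎))
    where open ≡-Reasoning

  ∸-square-≡[mod] : ∀ {r q} → r ℕ.≤ q → + (q ℕ.∸ r) * + (q ℕ.∸ r) ≡ + r * + r [mod q ]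
  ∸-square-≡[mod] {r} r≤q = ≡[mod]-trans (*-cong[mod] (∸-≡[mod]-neg r≤q) (∸-≡[mod]-neg r≤q))
                                         (≡[mod]-reflexive (lemma (+ r)))
    where lemma : ∀ r → - r * - r ≡ r * r
          lemma = solve-∀

module FiniteSum {c ℓ} (M : CommutativeMonoid c ℓ) where

  open import Data.Nat as ℕ using (ℕ; zero; suc; _<_; _≡ᵇ_)
  import Data.Nat.Properties as ℕ
  open import Data.Bool using (Bool; true; false; if_then_else_; _∧_)
  open import Data.List using (List; []; _∷_; upTo; foldr; _++_)
  import Data.List.Properties as List
  open import Data.Empty using (⊥-elim)
  open import Relation.Binary.Definitions using (tri<; tri≈; tri>)
  import Relation.Binary.PropositionalEquality as P
  open P using (_≡_)
  open import Data.Bool.Properties using (∧-conicalˡ; ∧-conicalʳ)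
  open Booleans using (≡true⇔⇒≡; ≡ᵇ-true; ≡ᵇ-false; ≡ᵇ-sound)

  open CommutativeMonoid M
  open import Relation.Binary.Reasoning.Setoid setoid
  open import Algebra.Properties.CommutativeSemigroup commutativeSemigroup using (interchange)

  ∑< : ℕ → (ℕ → Carrier) → Carrier
  ∑< zero    f = ε
  ∑< (suc n) f = ∑< n f ∙ f n

  syntax ∑< n (λ x → e) = ∑[ x < n ] e

  when : Bool → Carrier → Carrier
  when b x = if b then x else ε

  ∑-cong : ∀ n {f g} → (∀ x → x < n → f x ≈ g x) → ∑< n f ≈ ∑< n g
  ∑-cong zero    _   = refl
  ∑-cong (suc n) f≈g = ∙-cong (∑-cong n (λ x x<n → f≈g x (ℕ.m<n⇒m<1+n x<n))) (f≈g n ℕ.≤-refl)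

  ∑-zero : ∀ n → ∑[ x < n ] ε ≈ ε
  ∑-zero zero    = refl
  ∑-zero (suc n) = trans (identityʳ _) (∑-zero n)

  ∑-distrib : ∀ n f g → ∑[ x < n ] (f x ∙ g x) ≈ ∑< n f ∙ ∑< n g
  ∑-distrib zero    f g = sym (identityˡ ε)
  ∑-distrib (suc n) f g = trans (∙-congʳ (∑-distrib n f g)) (interchange _ _ _ _)

  ∑-split : ∀ m n f → ∑< (m ℕ.+ n) f ≈ ∑< m f ∙ ∑[ x < n ] f (m ℕ.+ x)
  ∑-split m zero f =
    P.subst (λ k → ∑< k f ≈ ∑< m f ∙ ε) (P.sym (ℕ.+-identityʳ m)) (sym (identityʳ _))
  ∑-split m (suc n) f =
    P.subst (λ k → ∑< k f ≈ ∑< m f ∙ (∑[ x < n ] f (m ℕ.+ x) ∙ f (m ℕ.+ n))) (P.sym (ℕ.+-suc m n))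
            (trans (∙-congʳ (∑-split m n f)) (assoc _ _ _))

  ∑-comm : ∀ m n (f : ℕ → ℕ → Carrier) → ∑[ x < m ] ∑[ y < n ] f x y ≈ ∑[ y < n ] ∑[ x < m ] f x y
  ∑-comm zero    n f = sym (∑-zero n)
  ∑-comm (suc m) n f = trans (∙-congʳ (∑-comm m n f)) (sym (∑-distrib n _ (λ y → f m y)))

  ∑-indicator : ∀ n t (g : ℕ → Carrier) → t < n → ∑[ x < n ] when (x ≡ᵇ t) (g x) ≈ g t
  ∑-indicator (suc n) t g t<1+n with ℕ.<-cmp t n
  ... | tri< t<n _ _ = begin
    ∑[ x < n ] when (x ≡ᵇ t) (g x) ∙ when (n ≡ᵇ t) (g n) ≈⟨ ∙-cong (∑-indicator n t g t<n) (reflexive n≢t) ⟩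
    g t ∙ ε                                               ≈⟨ identityʳ _ ⟩
    g t                                                   ∎
    where n≢t = P.cong (λ b → when b (g n)) (≡ᵇ-false (λ n≡t → ℕ.<-irrefl (P.sym n≡t) t<n))
  ... | tri≈ _ P.refl _ = begin
    ∑[ x < t ] when (x ≡ᵇ t) (g x) ∙ when (t ≡ᵇ t) (g t) ≈⟨ ∙-cong (trans (∑-cong t x≢t) (∑-zero t)) (reflexive t≡t) ⟩
    ε ∙ g t                                               ≈⟨ identityˡ _ ⟩
    g t                                                   ∎
    where t≡t = P.cong (λ b → when b (g t)) (≡ᵇ-true {t} P.refl)
          x≢t : ∀ x → x < t → when (x ≡ᵇ t) (g x) ≈ ε
          x≢t x x<t = reflexive (P.cong (λ b → when b (g x)) (≡ᵇ-false (λ x≡t → ℕ.<-irrefl x≡t x<t)))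
  ... | tri> _ _ n<t = ⊥-elim (ℕ.<⇒≱ n<t (ℕ.s≤s⁻¹ t<1+n))

  record IsInvolutionOn (n : ℕ) (U : ℕ → Bool) (φ : ℕ → ℕ) : Set where
    field
      <-closed   : ∀ x → x < n → U x ≡ true → φ x < n
      U-closed   : ∀ x → x < n → U x ≡ true → U (φ x) ≡ true
      involutive : ∀ x → x < n → U x ≡ true → φ (φ x) ≡ x

  -- Both sides equal the double sum of f y over the pairs (x, y) with U x and y = φ x,
  -- a set which the involution makes symmetric.
  ∑-involution : ∀ n (U : ℕ → Bool) (φ : ℕ → ℕ) (f : ℕ → Carrier) → IsInvolutionOn n U φ →
                 ∑[ x < n ] when (U x) (f (φ x)) ≈ ∑[ x < n ] when (U x) (f x)
  ∑-involution n U φ f inv = begin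
    ∑[ x < n ] when (U x) (f (φ x))                 ≈⟨ ∑-cong n (λ x x<n → sym (unfold x x<n f)) ⟩
    ∑[ x < n ] ∑[ y < n ] when (pairs x y) (f y)   ≈⟨ ∑-comm n n _ ⟩
    ∑[ y < n ] ∑[ x < n ] when (pairs x y) (f y)   ≈⟨ ∑-cong n (λ y y<n → ∑-cong n (λ x x<n → swap x<n y<n)) ⟩
    ∑[ y < n ] ∑[ x < n ] when (pairs y x) (f y)   ≈⟨ ∑-cong n (λ y y<n → unfold y y<n (λ _ → f y)) ⟩
    ∑[ y < n ] when (U y) (f y)                    ∎
    where
      open IsInvolutionOn inv
      pairs : ℕ → ℕ → Bool
      pairs x y = U x ∧ (y ≡ᵇ φ x)

      unfold : ∀ x → x < n → (g : ℕ → Carrier) → ∑[ y < n ] when (pairs x y) (g y) ≈ when (U x) (g (φ x))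
      unfold x x<n g with U x in ux
      ... | true  = ∑-indicator n (φ x) g (<-closed x x<n ux)
      ... | false = ∑-zero n

      flip : ∀ {x y} → x < n → pairs x y ≡ true → pairs y x ≡ true
      flip {x} {y} x<n e with ∧-conicalˡ (U x) _ e | ≡ᵇ-sound y (φ x) (∧-conicalʳ (U x) _ e)
      ... | ux | P.refl = P.cong₂ _∧_ (U-closed x x<n ux) (≡ᵇ-true (P.sym (involutive x x<n ux)))

      swap : ∀ {x y} → x < n → y < n → when (pairs x y) (f y) ≈ when (pairs y x) (f y)
      swap {y = y} x<n y<n = reflexive (P.cong (λ b → when b (f y)) (≡true⇔⇒≡ (flip x<n) (flip y<n)))

  foldr-upTo : ∀ n (b : ℕ → Bool) (f : ℕ → Carrier) →
               foldr (λ x s → if b x then f x ∙ s else s) ε (upTo n) ≈ ∑[ x < n ] when (b x) (f x)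
  foldr-upTo n b f = trans (filter-as-when (upTo n)) (list-sum-upTo n)
    where
      filter-as-when : ∀ L → foldr (λ x s → if b x then f x ∙ s else s) ε L
                           ≈ foldr (λ x s → when (b x) (f x) ∙ s) ε L
      filter-as-when []      = refl
      filter-as-when (x ∷ L) with b x
      ... | true  = ∙-congˡ (filter-as-when L)
      ... | false = trans (filter-as-when L) (sym (identityˡ _))

      g : ℕ → Carrier
      g x = when (b x) (f x)

      foldr-∙ : ∀ L z → foldr (λ x s → g x ∙ s) z L ≈ foldr (λ x s → g x ∙ s) ε L ∙ z
      foldr-∙ []      z = sym (identityˡ z)
      foldr-∙ (x ∷ L) z = trans (∙-congˡ (foldr-∙ L z)) (sym (assoc _ _ _))

      list-sum-upTo : ∀ n → foldr (λ x s → g x ∙ s) ε (upTo n) ≈ ∑< n g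
      list-sum-upTo zero    = refl
      list-sum-upTo (suc n) = begin
        foldr (λ x s → g x ∙ s) ε (upTo (suc n))           ≡⟨ P.cong (foldr _ ε) (P.sym (List.upTo-∷ʳ n)) ⟩
        foldr (λ x s → g x ∙ s) ε (upTo n ++ n ∷ [])       ≡⟨ List.foldr-++ _ ε (upTo n) (n ∷ []) ⟩
        foldr (λ x s → g x ∙ s) (g n ∙ ε) (upTo n)         ≈⟨ foldr-∙ (upTo n) _ ⟩
        foldr (λ x s → g x ∙ s) ε (upTo n) ∙ (g n ∙ ε)     ≈⟨ ∙-cong (list-sum-upTo n) (identityʳ _) ⟩
        ∑< n g ∙ g n                                       ∎

module Counting where

  open import Data.Nat as ℕ using (ℕ; zero; suc; _+_; _<_; _≤_; _≡ᵇ_; _<ᵇ_; z≤n)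
  import Data.Nat.Properties as ℕ
  open import Data.Bool using (Bool; true; false; _∧_)
  open import Data.Sum using (_⊎_; inj₁; inj₂)
  open import Data.Empty using (⊥; ⊥-elim)
  open import Relation.Binary.PropositionalEquality using (_≡_; refl; sym; trans; cong; module ≡-Reasoning)
  open Booleans using (≡ᵇ-true; ≡ᵇ-sound; <ᵇ-sound; <ᵇ-false)
  open FiniteSum ℕ.+-0-commutativeMonoid public

  count : ℕ → (ℕ → Bool) → ℕ
  count n P = ∑[ x < n ] when (P x) 1

  ∑-mono-≤ : ∀ n f g → (∀ x → x < n → f x ≤ g x) → ∑< n f ≤ ∑< n g
  ∑-mono-≤ zero    f g f≤g = z≤n
  ∑-mono-≤ (suc n) f g f≤g =
    ℕ.+-mono-≤ (∑-mono-≤ n f g (λ x x<n → f≤g x (ℕ.m<n⇒m<1+n x<n))) (f≤g n ℕ.≤-refl)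

  ∑-≡⇒pointwise : ∀ n f g → (∀ x → x < n → f x ≤ g x) → ∑< n f ≡ ∑< n g →
                  ∀ x → x < n → f x ≡ g x
  ∑-≡⇒pointwise (suc n) f g f≤g sums≡ = pointwise
    where
      f≤g′ : ∀ x → x < n → f x ≤ g x
      f≤g′ x x<n = f≤g x (ℕ.m<n⇒m<1+n x<n)
      init≡ : ∑< n f ≡ ∑< n g
      init≡ = ℕ.≤-antisym (∑-mono-≤ n f g f≤g′)
                (ℕ.≮⇒≥ (λ init< → ℕ.<-irrefl sums≡ (ℕ.+-mono-<-≤ init< (f≤g n ℕ.≤-refl))))
      pointwise : ∀ x → x < suc n → f x ≡ g x
      pointwise x x<1+n with ℕ.m≤n⇒m<n∨m≡n (ℕ.s≤s⁻¹ x<1+n)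
      ... | inj₁ x<n = ∑-≡⇒pointwise n f g f≤g′ init≡ x x<n
      ... | inj₂ refl = ℕ.+-cancelˡ-≡ (∑< n f) (f n) (g n) (trans sums≡ (cong (_+ g n) (sym init≡)))

  private
    trichotomy-count : ∀ (b : Bool) x y →
      when b 1 ≡ when (b ∧ (y ≡ᵇ x)) 1 + (when (b ∧ (x <ᵇ y)) 1 + when (b ∧ (y <ᵇ x)) 1)
    trichotomy-count false x y = refl
    trichotomy-count true  x y with y ≡ᵇ x in y≡x | x <ᵇ y in x<y | y <ᵇ x in y<x
    ... | true  | false | false = refl
    ... | false | true  | false = refl
    ... | false | false | true  = refl
    ... | true  | true  | _     = ⊥-elim (ℕ.<-irrefl (sym (≡ᵇ-sound y x y≡x)) (<ᵇ-sound x y x<y))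
    ... | true  | false | true  = ⊥-elim (ℕ.<-irrefl (≡ᵇ-sound y x y≡x) (<ᵇ-sound y x y<x))
    ... | false | true  | true  = ⊥-elim (ℕ.<-asym (<ᵇ-sound x y x<y) (<ᵇ-sound y x y<x))
    ... | false | false | false
      with () ← trans (sym y≡x) (≡ᵇ-true (ℕ.≤-antisym (ℕ.≮⇒≥ (<ᵇ-false x y x<y)) (ℕ.≮⇒≥ (<ᵇ-false y x y<x))))

  -- The non-fixed points of an involution come in pairs {x, f x}; count each pair by its smaller element.
  count-involution : ∀ n (U P : ℕ → Bool) (f : ℕ → ℕ) → IsInvolutionOn n U f →
    (∀ x → x < n → U x ≡ true → P (f x) ≡ P x) →
    count n (λ x → U x ∧ P x) ≡
      count n (λ x → (U x ∧ P x) ∧ (f x ≡ᵇ x))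
        + (count n (λ x → (U x ∧ P x) ∧ (x <ᵇ f x)) + count n (λ x → (U x ∧ P x) ∧ (x <ᵇ f x)))
  count-involution n U P f inv P-inv = begin
    count n UP
      ≡⟨ ∑-cong n (λ x _ → trichotomy-count (UP x) x (f x)) ⟩
    ∑[ x < n ] (fixed x + (below x + above x))
      ≡⟨ ∑-distrib n fixed _ ⟩
    ∑< n fixed + ∑[ x < n ] (below x + above x)
      ≡⟨ cong (∑< n fixed +_) (∑-distrib n below above) ⟩
    ∑< n fixed + (∑< n below + ∑< n above)
      ≡⟨ cong (λ s → ∑< n fixed + (∑< n below + s)) above≡below ⟩
    ∑< n fixed + (∑< n below + ∑< n below)
      ∎
    where
      open ≡-Reasoning
      UP : ℕ → Bool
      UP x = U x ∧ P x
      fixed below above : ℕ → ℕ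
      fixed x = when (UP x ∧ (f x ≡ᵇ x)) 1
      below x = when (UP x ∧ (x <ᵇ f x)) 1
      above x = when (UP x ∧ (f x <ᵇ x)) 1
      g : ℕ → ℕ
      g y = when (P y ∧ (y <ᵇ f y)) 1
      above-as-image : ∀ x → x < n → above x ≡ when (U x) (g (f x))
      above-as-image x x<n with U x in ux
      ... | false = refl
      ... | true rewrite P-inv x x<n ux | IsInvolutionOn.involutive inv x x<n ux = refl
      below-as-g : ∀ x → x < n → when (U x) (g x) ≡ below x
      below-as-g x _ with U x
      ... | false = refl
      ... | true  = refl
      above≡below : ∑< n above ≡ ∑< n below
      above≡below = trans (∑-cong n above-as-image) (trans (∑-involution n U f g inv) (∑-cong n below-as-g))

  when-disjoint-union : ∀ a b c → (a ≡ true → b ≡ true ⊎ c ≡ true) → (b ≡ true → a ≡ true) →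
    (c ≡ true → a ≡ true) → (b ≡ true → c ≡ true → ⊥) → when a 1 ≡ when b 1 + when c 1
  when-disjoint-union true  true  true  _ _ _ disjoint = ⊥-elim (disjoint refl refl)
  when-disjoint-union true  true  false _ _ _ _ = refl
  when-disjoint-union true  false true  _ _ _ _ = refl
  when-disjoint-union true  false false cover _ _ _ with cover refl
  ... | inj₁ ()
  ... | inj₂ ()
  when-disjoint-union false true  _     _ b⇒a _ _ with () ← b⇒a refl
  when-disjoint-union false false true  _ _ c⇒a _ with () ← c⇒a refl
  when-disjoint-union false false false _ _ _ _ = refl

module Mod4 where

  open import Data.Nat as ℕ using (ℕ; suc; _+_; _*_; _≡ᵇ_)
  open import Data.Nat.DivMod using (_%_; [m+kn]%n≡m%n)
  open import Data.Integer as ℤ using (ℤ; +_; -_)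
  open import Data.Bool using (if_then_else_)
  open import Data.Sum using (inj₁; inj₂)
  open import Data.Product using (_,_)
  open import Relation.Binary.PropositionalEquality using (_≡_; refl; sym; trans; cong; cong₂; subst)
  import Data.Nat.Tactic.RingSolver as ℕ-Solver
  open Parity using (even-or-odd)

  χ : ℕ → ℤ
  χ n = if n % 4 ≡ᵇ 1 then + 1 else - + 1

  data OddMod4 : ℕ → Set where
    one   : ∀ m → OddMod4 (1 + m * 4)
    three : ∀ m → OddMod4 (3 + m * 4)

  χ-one : ∀ m → χ (1 + m * 4) ≡ + 1
  χ-one m = cong (λ r → if r ≡ᵇ 1 then + 1 else - + 1) ([m+kn]%n≡m%n 1 m 4)

  χ-three : ∀ m → χ (3 + m * 4) ≡ - + 1
  χ-three m = cong (λ r → if r ≡ᵇ 1 then + 1 else - + 1) ([m+kn]%n≡m%n 3 m 4)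

  odd⇒OddMod4 : ∀ h → OddMod4 (suc (h + h))
  odd⇒OddMod4 h with even-or-odd h
  ... | m , inj₁ refl = subst OddMod4 (lemma m) (one m)
    where lemma : ∀ m → 1 + m * 4 ≡ suc (m + m + (m + m))
          lemma = ℕ-Solver.solve-∀
  ... | m , inj₂ refl = subst OddMod4 (lemma m) (three m)
    where lemma : ∀ m → 3 + m * 4 ≡ suc (suc (m + m) + suc (m + m))
          lemma = ℕ-Solver.solve-∀

  χ-* : ∀ {a b} → OddMod4 a → OddMod4 b → χ (a * b) ≡ χ a ℤ.* χ b
  χ-* (one m) (one n) =
    trans (cong χ (lemma m n)) (trans (χ-one (m + n + m * n * 4)) (sym (cong₂ ℤ._*_ (χ-one m) (χ-one n))))
    where lemma : ∀ m n → (1 + m * 4) * (1 + n * 4) ≡ 1 + (m + n + m * n * 4) * 4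
          lemma = ℕ-Solver.solve-∀
  χ-* (one m) (three n) =
    trans (cong χ (lemma m n)) (trans (χ-three (3 * m + n + m * n * 4)) (sym (cong₂ ℤ._*_ (χ-one m) (χ-three n))))
    where lemma : ∀ m n → (1 + m * 4) * (3 + n * 4) ≡ 3 + (3 * m + n + m * n * 4) * 4
          lemma = ℕ-Solver.solve-∀
  χ-* (three m) (one n) =
    trans (cong χ (lemma m n)) (trans (χ-three (m + 3 * n + m * n * 4)) (sym (cong₂ ℤ._*_ (χ-three m) (χ-one n))))
    where lemma : ∀ m n → (3 + m * 4) * (1 + n * 4) ≡ 3 + (m + 3 * n + m * n * 4) * 4
          lemma = ℕ-Solver.solve-∀
  χ-* (three m) (three n) =
    trans (cong χ (lemma m n)) (trans (χ-one (2 + 3 * m + 3 * n + m * n * 4)) (sym (cong₂ ℤ._*_ (χ-three m) (χ-three n))))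
    where lemma : ∀ m n → (3 + m * 4) * (3 + n * 4) ≡ 1 + (2 + 3 * m + 3 * n + m * n * 4) * 4
          lemma = ℕ-Solver.solve-∀

module Legendre (h : Nat.ℕ) (prime : Prime (Nat.suc (h Nat.+ h))) where

  open import Data.Nat as ℕ using (ℕ; zero; suc; _+_; _∸_; _<_; _≤_; _≡ᵇ_; _<ᵇ_; z≤n; s≤s)
  open import Data.Nat.Primality using (Prime; euclidsLemma; ¬prime[1])
  import Data.Nat.Properties as ℕ
  import Data.Nat.Divisibility as ℕ
  open import Data.Nat.Coprimality as Coprimality using ()
  open import Data.Integer as ℤ using (ℤ; +_; _*_; -_; _-_; ∣_∣)
  import Data.Integer.Properties as ℤ
  open import Data.Integer.Divisibility.Signed using (∣ᵤ⇒∣; ∣⇒∣ᵤ)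
  open import Data.Integer.Tactic.RingSolver using (solve-∀)
  open import Data.Bool using (Bool; true; false; if_then_else_; not; _∧_)
  open import Data.Bool.Properties using (∧-conicalˡ; ∧-conicalʳ; ¬-not)
  open import Data.List using (List; []; _∷_; upTo; foldr)
  open import Data.List.Relation.Unary.Any using (here; there)
  open import Data.List.Membership.Propositional using (_∈_)
  open import Data.List.Membership.Propositional.Properties using (∈-upTo⁺)
  open import Data.Product using (∃; _,_)
  open import Data.Sum as Sum using (_⊎_; inj₁; inj₂)
  open import Data.Empty using (⊥; ⊥-elim)
  open import Relation.Nullary using (¬_)
  open import Relation.Binary.PropositionalEquality
    using (_≡_; _≢_; refl; sym; trans; cong; cong₂; subst; module ≡-Reasoning)
  open import Defs using (modℤ; isSqMod; legendre; invMod)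
  open Booleans
  open Parity
  open Congruence
  open Counting
  open Mod4 using (χ; χ-one; χ-three)
  import Data.Nat.Tactic.RingSolver as ℕ-Solver

  p : ℕ
  p = suc (h + h)

  h≢0 : h ≢ 0
  h≢0 refl = ¬prime[1] prime

  IsSquare : ℤ → Set
  IsSquare a = ∃ λ t → t * t ≡ a [mod p ]

  IsSquare-resp : ∀ {a b} → a ≡ b [mod p ] → IsSquare a → IsSquare b
  IsSquare-resp a≡b (t , t²≡a) = t , ≡[mod]-trans t²≡a a≡b

  IsSquare-* : ∀ {a b} → IsSquare a → IsSquare b → IsSquare (a * b)
  IsSquare-* (s , s²≡a) (t , t²≡b) = s * t , ≡[mod]-trans (≡[mod]-reflexive (lemma s t)) (*-cong[mod] s²≡a t²≡b)
    where lemma : ∀ s t → s * t * (s * t) ≡ s * s * (t * t)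
          lemma = solve-∀

  square-isSquare : ∀ u → IsSquare (u * u)
  square-isSquare u = u , ≡[mod]-refl

  private
    Root : ℤ → ℕ → Bool
    Root a x = modℤ (+ x * + x - a) p ≡ᵇ 0

    search : ℤ → List ℕ → Bool
    search a = foldr (λ x b → if Root a x then true else b) false

    search-sound : ∀ a L → search a L ≡ true → ∃ λ x → Root a x ≡ true
    search-sound a (x ∷ L) found with Root a x in root
    ... | true  = x , root
    ... | false = search-sound a L found

    search-complete : ∀ a L x → x ∈ L → Root a x ≡ true → search a L ≡ true
    search-complete a (y ∷ L) x x∈L root with Root a y in root′
    ... | true = refl
    search-complete a (y ∷ L) x (here refl)  root | false with () ← trans (sym root) root′
    search-complete a (y ∷ L) x (there x∈L) root | false = search-complete a L x x∈L root

    search-cong : ∀ a b L → (∀ x → Root a x ≡ Root b x) → search a L ≡ search b L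
    search-cong a b []      _    = refl
    search-cong a b (x ∷ L) same rewrite same x with Root b x
    ... | true  = refl
    ... | false = search-cong a b L same

  isSqMod-sound : ∀ a → isSqMod a p ≡ true → IsSquare a
  isSqMod-sound a found with search-sound a (upTo p) found
  ... | x , root = + x , (begin
    + x * + x              ≡⟨ lemma (+ x * + x) a ⟩
    (+ x * + x - a) ℤ.+ a  ≈⟨ +-cong[mod] (modℤ-cong⁻¹ {+ x * + x - a} {+ 0} (≡ᵇ-sound _ 0 root)) (≡[mod]-refl {a}) ⟩
    + 0 ℤ.+ a              ≡⟨ ℤ.+-identityˡ a ⟩
    a                      ∎)
    where
      open ≡[mod]-Reasoning p
      lemma : ∀ y a → y ≡ (y - a) ℤ.+ a
      lemma = solve-∀

  isSqMod-complete : ∀ a → IsSquare a → isSqMod a p ≡ true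
  isSqMod-complete a (t , t²≡a) =
    search-complete a (upTo p) (modℤ t p) (∈-upTo⁺ (modℤ-< t (h + h))) (≡ᵇ-true (modℤ-cong root))
    where
      r = + modℤ t p
      root : r * r - a ≡ + 0 [mod p ]
      root = begin
        r * r - a    ≈⟨ +-cong[mod] (*-cong[mod] (modℤ-≡[mod] t (h + h)) (modℤ-≡[mod] t (h + h))) (≡[mod]-refl { - a}) ⟩
        t * t - a    ≈⟨ +-cong[mod] t²≡a (≡[mod]-refl { - a}) ⟩
        a - a        ≡⟨ ℤ.+-inverseʳ a ⟩
        + 0          ∎
        where open ≡[mod]-Reasoning p

  isSqMod-cong : ∀ {a b} → a ≡ b [mod p ] → isSqMod a p ≡ isSqMod b p
  isSqMod-cong {a} {b} a≡b = search-cong a b (upTo p)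
    (λ x → cong (_≡ᵇ 0) (modℤ-cong (+-cong[mod] (≡[mod]-refl {+ x * + x}) (-‿cong[mod] a≡b))))

  legendre-cong : ∀ {a b} → a ≡ b [mod p ] → legendre a p ≡ legendre b p
  legendre-cong a≡b = cong₂ (λ r s → if r ≡ᵇ 0 then + 0 else (if s then + 1 else - + 1))
                            (modℤ-cong a≡b) (isSqMod-cong a≡b)

  sign : Bool → ℤ
  sign b = if b then + 1 else - + 1

  isUnit⇒modℤ≢0 : ∀ {x} → IsUnit p x → modℤ x p ≢ 0
  isUnit⇒modℤ≢0 {x} (y , xy≡1) x≡0 =
    h≢0 (ℕ.m+n≡0⇒m≡0 h (ℕ.suc-injective (ℕ.∣1⇒≡1 (∣⇒∣ᵤ (divides-difference 1≡0)))))
    where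
      1≡0 : + 1 ≡ + 0 [mod p ]
      1≡0 = begin
        + 1       ≈⟨ ≡[mod]-sym xy≡1 ⟩
        x * y     ≈⟨ *-congʳ[mod] y (modℤ-cong⁻¹ {x} {+ 0} x≡0) ⟩
        + 0 * y   ≡⟨ ℤ.*-zeroˡ y ⟩
        + 0       ∎
        where open ≡[mod]-Reasoning p

  legendre-unit : ∀ {x} → IsUnit p x → legendre x p ≡ sign (isSqMod x p)
  legendre-unit {x} x-unit with modℤ x p in x%p
  ... | zero  = ⊥-elim (isUnit⇒modℤ≢0 {x} x-unit x%p)
  ... | suc _ = refl

  nonzero : ℕ → Bool
  nonzero x = not (x ≡ᵇ 0)

  nonzero-sound : ∀ {x} → nonzero x ≡ true → x ≢ 0
  nonzero-sound {zero}  () refl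
  nonzero-sound {suc x} _  ()

  nonzero-intro : ∀ {x} → x ≢ 0 → nonzero x ≡ true
  nonzero-intro {zero}  x≢0 = ⊥-elim (x≢0 refl)
  nonzero-intro {suc x} _   = refl

  nonzero-isUnit : ∀ {x} → x < p → nonzero x ≡ true → IsUnit p (+ x)
  nonzero-isUnit {suc x} x<p _ = coprime⇒IsUnit (Coprimality.sym (Coprimality.prime⇒coprime prime x<p))

  isUnit-nonzero : ∀ {x} → x < p → IsUnit p (+ x) → nonzero x ≡ true
  isUnit-nonzero {x} x<p x-unit = nonzero-intro (λ x≡0 → isUnit⇒modℤ≢0 {+ x} x-unit (trans (modℤ-residue x<p) x≡0))

  square-roots : ∀ {x t} → x < p → t < p → t ≢ 0 → + x * + x ≡ + t * + t [mod p ] → x ≡ t ⊎ x ≡ p ∸ t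
  square-roots {x} {t} x<p t<p t≢0 (mod-divides p∣x²-t²)
    with euclidsLemma ∣ + x - + t ∣ (x + t) prime
           (subst (p ℕ.∣_) (trans (cong ∣_∣ (factor (+ x) (+ t))) (ℤ.abs-* (+ x - + t) (+ x ℤ.+ + t))) (∣⇒∣ᵤ p∣x²-t²))
    where factor : ∀ x t → x * x - t * t ≡ (x - t) * (x ℤ.+ t)
          factor = solve-∀
  ... | inj₁ p∣x-t = inj₁ (residues-unique x<p t<p (mod-divides (∣ᵤ⇒∣ p∣x-t)))
  ... | inj₂ (ℕ.divides zero x+t≡0) = ⊥-elim (t≢0 (ℕ.m+n≡0⇒n≡0 x x+t≡0))
  ... | inj₂ (ℕ.divides (suc zero) x+t≡p) =
    inj₂ (trans (sym (ℕ.m+n∸n≡m x t)) (cong (_∸ t) (trans x+t≡p (ℕ.+-identityʳ p))))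
  ... | inj₂ (ℕ.divides (suc (suc k)) x+t≡p*) =
    ⊥-elim (ℕ.<-irrefl refl (ℕ.<-≤-trans (ℕ.+-mono-< x<p t<p)
                                          (subst (p + p ≤_) (sym x+t≡p*) (ℕ.+-monoʳ-≤ p (ℕ.m≤m+n p _)))))

  negation-involution : IsInvolutionOn p nonzero (p ∸_)
  negation-involution = record
    { <-closed   = λ { (suc x) _ _ → s≤s (ℕ.m∸n≤m (h + h) x) }
    ; U-closed   = λ x x<p _ → nonzero-intro (λ p∸x≡0 → ℕ.<⇒≱ x<p (ℕ.m∸n≡0⇒m≤n p∸x≡0))
    ; involutive = λ x x<p _ → ℕ.m∸[m∸n]≡n (ℕ.<⇒≤ x<p)
    }

  nonzero-count : count p nonzero ≡ h + h
  nonzero-count = go (h + h)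
    where go : ∀ n → count (suc n) nonzero ≡ n
          go zero    = refl
          go (suc n) = trans (cong (_+ 1) (go n)) (ℕ.+-comm n 1)

  square? : ℕ → Bool
  square? r = isSqMod (+ r) p

  square-residue : ℕ → ℕ
  square-residue x = modℤ (+ x * + x) p

  square-residue-≡ : ∀ x → + square-residue x ≡ + x * + x [mod p ]
  square-residue-≡ x = modℤ-≡[mod] (+ x * + x) (h + h)

  square-residue-nonzero : ∀ {x} → x < p → nonzero x ≡ true → nonzero (square-residue x) ≡ true
  square-residue-nonzero {x} x<p x≢0 = isUnit-nonzero (modℤ-< (+ x * + x) (h + h))
    (IsUnit-resp (≡[mod]-sym (square-residue-≡ x)) (IsUnit-* {p} {+ x} {+ x} x-unit x-unit))
    where x-unit = nonzero-isUnit x<p x≢0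

  squareCount : ℕ
  squareCount = count p (λ y → nonzero y ∧ square? y)

  private
    false≢true : false ≢ true
    false≢true ()

    when-∧-false : ∀ b → when (b ∧ false) 1 ≡ 0
    when-∧-false true  = refl
    when-∧-false false = refl

    RootOf : ℕ → ℕ → Bool
    RootOf y x = nonzero x ∧ (y ≡ᵇ square-residue x)

    root-is-root : ∀ {y r} → y < p → r < p → nonzero r ≡ true → + r * + r ≡ + y [mod p ] → RootOf y r ≡ true
    root-is-root {y} {r} y<p r<p r≢0 r²≡y = cong₂ _∧_ r≢0
      (≡ᵇ-true (residues-unique y<p (modℤ-< (+ r * + r) (h + h))
        (≡[mod]-trans (≡[mod]-sym r²≡y) (≡[mod]-sym (square-residue-≡ r)))))

    root-count-square : ∀ {y r} → y < p → nonzero y ≡ true → r * r ≡ + y [mod p ] → count p (RootOf y) ≡ 1 + 1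
    root-count-square {y} {r} y<p y≢0 r²≡y =
      trans (∑-cong p two-roots)
        (trans (∑-distrib p (λ x → when (x ≡ᵇ t) 1) (λ x → when (x ≡ᵇ p ∸ t) 1))
               (cong₂ _+_ (∑-indicator p t (λ _ → 1) t<p) (∑-indicator p (p ∸ t) (λ _ → 1) -t<p)))
      where
        t = modℤ r p
        t<p : t < p
        t<p = modℤ-< r (h + h)
        t²≡y : + t * + t ≡ + y [mod p ]
        t²≡y = ≡[mod]-trans (*-cong[mod] (modℤ-≡[mod] r (h + h)) (modℤ-≡[mod] r (h + h))) r²≡y
        t≢0 : t ≢ 0
        t≢0 t≡0 = nonzero-sound y≢0 (residues-unique y<p (s≤s z≤n)
                    (subst (λ z → + y ≡ + z * + z [mod p ]) t≡0 (≡[mod]-sym t²≡y)))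
        -t<p : p ∸ t < p
        -t<p = IsInvolutionOn.<-closed negation-involution t t<p (nonzero-intro t≢0)
        -t²≡y : + (p ∸ t) * + (p ∸ t) ≡ + y [mod p ]
        -t²≡y = ≡[mod]-trans (∸-square-≡[mod] (ℕ.<⇒≤ t<p)) t²≡y
        x²≡t² : ∀ {x} → RootOf y x ≡ true → + x * + x ≡ + t * + t [mod p ]
        x²≡t² {x} root-x = begin
          + x * + x               ≈⟨ ≡[mod]-sym (square-residue-≡ x) ⟩
          + square-residue x      ≡⟨ cong +_ (sym (≡ᵇ-sound y (square-residue x) (∧-conicalʳ (nonzero x) _ root-x))) ⟩
          + y                     ≈⟨ ≡[mod]-sym t²≡y ⟩
          + t * + t               ∎
          where open ≡[mod]-Reasoning p
        two-roots : ∀ x → x < p → when (RootOf y x) 1 ≡ when (x ≡ᵇ t) 1 + when (x ≡ᵇ p ∸ t) 1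
        two-roots x x<p = when-disjoint-union (RootOf y x) (x ≡ᵇ t) (x ≡ᵇ p ∸ t) cover b⇒a c⇒a disjoint
          where
            cover : RootOf y x ≡ true → (x ≡ᵇ t) ≡ true ⊎ (x ≡ᵇ p ∸ t) ≡ true
            cover root-x = Sum.map ≡ᵇ-true ≡ᵇ-true (square-roots x<p t<p t≢0 (x²≡t² {x} root-x))
            c⇒a : (x ≡ᵇ p ∸ t) ≡ true → RootOf y x ≡ true
            c⇒a x≡-t = subst (λ z → RootOf y z ≡ true) (sym (≡ᵇ-sound x (p ∸ t) x≡-t))
                         (root-is-root y<p -t<p (IsInvolutionOn.U-closed negation-involution t t<p (nonzero-intro t≢0)) -t²≡y)
            disjoint : (x ≡ᵇ t) ≡ true → (x ≡ᵇ p ∸ t) ≡ true → ⊥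
            disjoint x≡t x≡-t = even≢odd t h (begin
              t + t         ≡⟨ cong (λ z → t + z) (trans (sym (≡ᵇ-sound x t x≡t)) (≡ᵇ-sound x (p ∸ t) x≡-t)) ⟩
              t + (p ∸ t)   ≡⟨ ℕ.m+[n∸m]≡n (ℕ.<⇒≤ t<p) ⟩
              p             ∎)
              where open ≡-Reasoning
            b⇒a : (x ≡ᵇ t) ≡ true → RootOf y x ≡ true
            b⇒a x≡t = subst (λ z → RootOf y z ≡ true) (sym (≡ᵇ-sound x t x≡t))
                            (root-is-root y<p t<p (nonzero-intro t≢0) t²≡y)
    root-square : ∀ {y} x → RootOf y x ≡ true → IsSquare (+ y)
    root-square {y} x root = + x , ≡[mod]-trans (≡[mod]-sym (square-residue-≡ x))
      (≡[mod]-reflexive (cong +_ (sym (≡ᵇ-sound y (square-residue x) (∧-conicalʳ (nonzero x) _ root)))))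

    root-count : ∀ y → y < p → nonzero y ≡ true → count p (RootOf y) ≡ when (square? y) 1 + when (square? y) 1
    root-count y y<p y≢0 with square? y in y-square
    ... | false = trans (∑-cong p (λ x _ → cong (λ b → when b 1) (¬-not (no-root x)))) (∑-zero p)
      where
        no-root : ∀ x → RootOf y x ≢ true
        no-root x root = false≢true (trans (sym y-square) (isSqMod-complete (+ y) (root-square x root)))
    ... | true = let r , r²≡y = isSqMod-sound (+ y) y-square in root-count-square {y} {r} y<p y≢0 r²≡y

    Pair : ℕ → ℕ → Bool
    Pair x y = nonzero y ∧ RootOf y x

    pairs-with-y : ∀ y → y < p → count p (λ x → Pair x y) ≡ when (nonzero y ∧ square? y) 1 + when (nonzero y ∧ square? y) 1
    pairs-with-y y y<p with nonzero y in y≢0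
    ... | false = ∑-zero p
    ... | true  = root-count y y<p y≢0

    pairs-with-x : ∀ x → x < p → count p (Pair x) ≡ when (nonzero x) 1
    pairs-with-x x x<p with nonzero x in x≢0
    ... | false = trans (∑-cong p (λ y _ → when-∧-false (nonzero y))) (∑-zero p)
    ... | true  = trans (∑-cong p only-square) (∑-indicator p s (λ _ → 1) (modℤ-< (+ x * + x) (h + h)))
      where
        s = square-residue x
        only-square : ∀ y → y < p → when (nonzero y ∧ (y ≡ᵇ s)) 1 ≡ when (y ≡ᵇ s) 1
        only-square y _ with y ≡ᵇ s in y≡s
        ... | false = when-∧-false (nonzero y)
        ... | true  = cong (λ b → when (b ∧ true) 1)
                           (trans (cong nonzero (≡ᵇ-sound y s y≡s)) (square-residue-nonzero x<p x≢0))

  squareCount-double : squareCount + squareCount ≡ h + h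
  squareCount-double = begin
    squareCount + squareCount                           ≡⟨ ∑-distrib p _ _ ⟨
    ∑[ y < p ] (when (nonzero y ∧ square? y) 1 + when (nonzero y ∧ square? y) 1)
                                                        ≡⟨ ∑-cong p pairs-with-y ⟨
    ∑[ y < p ] ∑[ x < p ] when (Pair x y) 1             ≡⟨ ∑-comm p p (λ x y → when (Pair x y) 1) ⟨
    ∑[ x < p ] ∑[ y < p ] when (Pair x y) 1             ≡⟨ ∑-cong p pairs-with-x ⟩
    count p nonzero                                     ≡⟨ nonzero-count ⟩
    h + h                                               ∎
    where open ≡-Reasoning

  squareCount≡h : squareCount ≡ h
  squareCount≡h = double-injective squareCount-double

  square?-sound : ∀ {r} → square? r ≡ true → IsSquare (+ r)
  square?-sound {r} = isSqMod-sound (+ r)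

  square?-complete : ∀ {r} → IsSquare (+ r) → square? r ≡ true
  square?-complete {r} = isSqMod-complete (+ r)

  IsSquare-neg : IsSquare (- + 1) → ∀ {a} → IsSquare a → IsSquare (- a)
  IsSquare-neg -1-square {a} a-square =
    IsSquare-resp (≡[mod]-reflexive (lemma a)) (IsSquare-* -1-square a-square)
    where lemma : ∀ a → - + 1 * a ≡ - a
          lemma = solve-∀

  IsSquare-neg⁻¹ : IsSquare (- + 1) → ∀ {a} → IsSquare (- a) → IsSquare a
  IsSquare-neg⁻¹ -1-square {a} -a-square =
    IsSquare-resp (≡[mod]-reflexive (ℤ.neg-involutive a)) (IsSquare-neg -1-square -a-square)

  -1-square-from : ∀ {a} → IsUnit p a → IsSquare a → IsSquare (- a) → IsSquare (- + 1)
  -1-square-from {a} (v , av≡1) a-square -a-square =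
    IsSquare-resp -a·v²a≡-1 (IsSquare-* -a-square (IsSquare-* (square-isSquare v) a-square))
    where
      lemma : ∀ a v → - a * (v * v * a) ≡ - ((a * v) * (a * v))
      lemma = solve-∀
      -a·v²a≡-1 : - a * (v * v * a) ≡ - + 1 [mod p ]
      -a·v²a≡-1 = ≡[mod]-trans (≡[mod]-reflexive (lemma a v)) (-‿cong[mod] (*-cong[mod] av≡1 av≡1))

  IsSquare-∸ : ∀ {x} → x < p → IsSquare (+ (p ∸ x)) → IsSquare (- + x)
  IsSquare-∸ x<p = IsSquare-resp (∸-≡[mod]-neg (ℕ.<⇒≤ x<p))

  IsSquare-∸⁻¹ : ∀ {x} → x < p → IsSquare (- + x) → IsSquare (+ (p ∸ x))
  IsSquare-∸⁻¹ x<p = IsSquare-resp (≡[mod]-sym (∸-≡[mod]-neg (ℕ.<⇒≤ x<p)))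

  private
    when-∧-false′ : ∀ b {c} → c ≡ false → when (b ∧ c) 1 ≡ 0
    when-∧-false′ b refl = when-∧-false b

  -- When -1 is a square, x ↦ p - x pairs the nonzero squares without fixed points,
  -- so their number h would be even.
  -1-nonsquare : ∀ m → h ≡ suc (m + m) → ¬ IsSquare (- + 1)
  -1-nonsquare m h≡odd -1-square = even≢odd pairs m (trans (sym squareCount≡2pairs) (trans squareCount≡h h≡odd))
    where
      pairs = count p (λ x → (nonzero x ∧ square? x) ∧ (x <ᵇ p ∸ x))
      invariant : ∀ x → x < p → nonzero x ≡ true → square? (p ∸ x) ≡ square? x
      invariant x x<p _ = ≡true⇔⇒≡
        (λ sq → square?-complete (IsSquare-neg⁻¹ -1-square (IsSquare-∸ x<p (square?-sound sq))))
        (λ sq → square?-complete (IsSquare-∸⁻¹ x<p (IsSquare-neg -1-square (square?-sound sq))))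
      no-fixed-point : ∀ x → x < p → when ((nonzero x ∧ square? x) ∧ (p ∸ x ≡ᵇ x)) 1 ≡ 0
      no-fixed-point x x<p = when-∧-false′ (nonzero x ∧ square? x) (≡ᵇ-false (λ p∸x≡x →
        even≢odd x h (trans (cong (λ z → x + z) (sym p∸x≡x)) (ℕ.m+[n∸m]≡n (ℕ.<⇒≤ x<p)))))
      squareCount≡2pairs : squareCount ≡ pairs + pairs
      squareCount≡2pairs = trans (count-involution p nonzero square? (p ∸_) negation-involution invariant)
                                 (cong (_+ (pairs + pairs)) (trans (∑-cong p no-fixed-point) (∑-zero p)))

  inverse : ℕ → ℕ
  inverse x = invMod (+ x) p

  private
    inverse-< : ∀ x → inverse x < p
    inverse-< x = invMod-< (+ x) (h + h)

    inverse-inverse : ∀ {x} → x < p → nonzero x ≡ true → + x * + inverse x ≡ + 1 [mod p ]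
    inverse-inverse {x} x<p x≢0 = invMod-inverse {+ x} {h + h} (nonzero-isUnit x<p x≢0)

    inverse-nonzero : ∀ {x} → x < p → nonzero x ≡ true → nonzero (inverse x) ≡ true
    inverse-nonzero {x} x<p x≢0 = isUnit-nonzero (inverse-< x) (IsUnit-inverse {p} {+ x} (inverse-inverse x<p x≢0))

  1<p : 1 < p
  1<p = s≤s (ℕ.n≢0⇒n>0 (λ h+h≡0 → h≢0 (ℕ.m+n≡0⇒m≡0 h h+h≡0)))

  inverse-involution : IsInvolutionOn p nonzero inverse
  inverse-involution = record
    { <-closed   = λ x _ _ → inverse-< x
    ; U-closed   = λ x x<p x≢0 → inverse-nonzero x<p x≢0
    ; involutive = λ x x<p x≢0 → residues-unique (inverse-< (inverse x)) x<p
        (inverse-unique {p} {+ inverse x} (inverse-inverse (inverse-< x) (inverse-nonzero x<p x≢0))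
                        (≡[mod]-trans (≡[mod]-reflexive (ℤ.*-comm (+ inverse x) (+ x))) (inverse-inverse x<p x≢0)))
    }

  private
    inverse-square : ∀ {x} → x < p → nonzero x ≡ true → square? x ≡ true → square? (inverse x) ≡ true
    inverse-square {x} x<p x≢0 x-square = square?-complete
      (IsSquare-resp i²x≡i (IsSquare-* (square-isSquare (+ i)) (square?-sound x-square)))
      where
        i = inverse x
        lemma : ∀ a b → a * a * b ≡ a * (b * a)
        lemma = solve-∀
        i²x≡i : + i * + i * + x ≡ + i [mod p ]
        i²x≡i = begin
          + i * + i * + x    ≡⟨ lemma (+ i) (+ x) ⟩
          + i * (+ x * + i)  ≈⟨ *-congˡ[mod] (+ i) (inverse-inverse x<p x≢0) ⟩
          + i * + 1          ≡⟨ ℤ.*-identityʳ (+ i) ⟩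
          + i                ∎
          where open ≡[mod]-Reasoning p

  private
    inverse-1 : inverse 1 ≡ 1
    inverse-1 = residues-unique (inverse-< 1) 1<p (inverse-unique {p} {+ 1} (inverse-inverse 1<p refl) ≡[mod]-refl)

    inverse-square? : ∀ x → x < p → nonzero x ≡ true → square? (inverse x) ≡ square? x
    inverse-square? x x<p x≢0 = ≡true⇔⇒≡
      (λ sq → subst (λ z → square? z ≡ true) (IsInvolutionOn.involutive inverse-involution x x<p x≢0)
                    (inverse-square (inverse-< x) (inverse-nonzero x<p x≢0) sq))
      (inverse-square x<p x≢0)

    inverse-fixed-squares : ¬ IsSquare (- + 1) → ∀ x → x < p →
                            ((nonzero x ∧ square? x) ∧ (inverse x ≡ᵇ x)) ≡ (x ≡ᵇ 1)
    inverse-fixed-squares ¬-1-square x x<p = ≡true⇔⇒≡ only-1 1-fixed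
      where
        only-1 : ((nonzero x ∧ square? x) ∧ (inverse x ≡ᵇ x)) ≡ true → (x ≡ᵇ 1) ≡ true
        only-1 fixed = Sum.[ ≡ᵇ-true , (λ x≡p∸1 → ⊥-elim (¬-1-square (IsSquare-∸ 1<p
                         (subst (λ z → IsSquare (+ z)) x≡p∸1 (square?-sound x-square))))) ]
                       (square-roots x<p 1<p (λ ()) x²≡1)
          where
            nonzero-square = ∧-conicalˡ (nonzero x ∧ square? x) (inverse x ≡ᵇ x) fixed
            x-square = ∧-conicalʳ (nonzero x) (square? x) nonzero-square
            x²≡1 : + x * + x ≡ + 1 * + 1 [mod p ]
            x²≡1 = subst (λ z → + x * + z ≡ + 1 [mod p ])
                         (≡ᵇ-sound (inverse x) x (∧-conicalʳ (nonzero x ∧ square? x) (inverse x ≡ᵇ x) fixed))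
                         (inverse-inverse x<p (∧-conicalˡ (nonzero x) (square? x) nonzero-square))
        1-fixed : (x ≡ᵇ 1) ≡ true → ((nonzero x ∧ square? x) ∧ (inverse x ≡ᵇ x)) ≡ true
        1-fixed x≡1 = subst (λ z → ((nonzero z ∧ square? z) ∧ (inverse z ≡ᵇ z)) ≡ true) (sym (≡ᵇ-sound x 1 x≡1))
                            (cong₂ _∧_ (square?-complete {1} (square-isSquare (+ 1))) (≡ᵇ-true inverse-1))

  -- When -1 is not a square, x ↦ x⁻¹ pairs the nonzero squares leaving only 1 fixed
  -- (its other candidate p - 1 ≡ -1 is not a square), so their number h would be odd.
  -1-square : ∀ m → h ≡ m + m → IsSquare (- + 1)
  -1-square m h≡even with isSqMod (- + 1) p in decided
  ... | true  = isSqMod-sound (- + 1) decided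
  ... | false = ⊥-elim (even≢odd m pairs (trans (sym h≡even) (trans (sym squareCount≡h) squareCount≡1+2pairs)))
    where
      ¬-1-square : ¬ IsSquare (- + 1)
      ¬-1-square -1-square = false≢true (trans (sym decided) (isSqMod-complete (- + 1) -1-square))
      pairs = count p (λ x → (nonzero x ∧ square? x) ∧ (x <ᵇ inverse x))
      squareCount≡1+2pairs : squareCount ≡ suc (pairs + pairs)
      squareCount≡1+2pairs = trans (count-involution p nonzero square? inverse inverse-involution inverse-square?)
        (cong (_+ (pairs + pairs))
              (trans (∑-cong p (λ x x<p → cong (λ b → when b 1) (inverse-fixed-squares ¬-1-square x x<p)))
                     (∑-indicator p 1 (λ _ → 1) 1<p)))

  nonsquareCount : ℕ
  nonsquareCount = count p (λ y → nonzero y ∧ not (square? y))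

  nonsquareCount≡squareCount : nonsquareCount ≡ squareCount
  nonsquareCount≡squareCount = ℕ.+-cancelˡ-≡ squareCount nonsquareCount squareCount
    (trans (sym (∑-distrib p _ _)) (trans (sym (∑-cong p split)) (trans nonzero-count (sym squareCount-double))))
    where
      split : ∀ y → y < p → when (nonzero y) 1 ≡ when (nonzero y ∧ square? y) 1 + when (nonzero y ∧ not (square? y)) 1
      split y _ with nonzero y | square? y
      ... | false | _     = refl
      ... | true  | true  = refl
      ... | true  | false = refl

  negated-nonsquareCount : count p (λ y → nonzero y ∧ not (square? (p ∸ y))) ≡ nonsquareCount
  negated-nonsquareCount = trans (∑-cong p (λ y _ → when-∧ (nonzero y) (not (square? (p ∸ y)))))
    (trans (∑-involution p nonzero (p ∸_) (λ z → when (not (square? z)) 1) negation-involution)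
           (∑-cong p (λ y _ → sym (when-∧ (nonzero y) (not (square? y))))))
    where
      when-∧ : ∀ b c → when (b ∧ c) 1 ≡ when b (when c 1)
      when-∧ false _ = refl
      when-∧ true  _ = refl

  -- For h odd the nonzero squares lie inside {y ≠ 0 : -y nonsquare} (else -1 would be a square),
  -- and both sets have h elements, so they coincide.
  nonsquare-neg-square : ∀ m → h ≡ suc (m + m) → ∀ {x} → IsUnit p x → ¬ IsSquare x → IsSquare (- x)
  nonsquare-neg-square m h≡odd {x} x-unit x-nonsquare =
    IsSquare-resp (-‿cong[mod] (modℤ-≡[mod] x (h + h))) (IsSquare-∸ r<p (square?-sound -r-square))
    where
      squares⊆negated : ∀ y → y < p → when (nonzero y ∧ square? y) 1 ≤ when (nonzero y ∧ not (square? (p ∸ y))) 1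
      squares⊆negated y y<p with nonzero y in y≢0 | square? y in y-square | square? (p ∸ y) in -y-square
      ... | false | _     | _     = z≤n
      ... | true  | false | _     = z≤n
      ... | true  | true  | false = ℕ.≤-refl
      ... | true  | true  | true  = ⊥-elim (-1-nonsquare m h≡odd (-1-square-from (nonzero-isUnit y<p y≢0)
                                      (square?-sound y-square) (IsSquare-∸ y<p (square?-sound -y-square))))

      r = modℤ x p
      r<p = modℤ-< x (h + h)

      r-nonsquare : square? r ≡ false
      r-nonsquare = ¬-not (λ r-square → x-nonsquare (IsSquare-resp (modℤ-≡[mod] x (h + h)) (square?-sound r-square)))

      r≢0 : nonzero r ≡ true
      r≢0 = nonzero-intro (isUnit⇒modℤ≢0 {x} x-unit)

      at-r : when (nonzero r ∧ square? r) 1 ≡ when (nonzero r ∧ not (square? (p ∸ r))) 1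
      at-r = ∑-≡⇒pointwise p _ _ squares⊆negated
               (sym (trans negated-nonsquareCount nonsquareCount≡squareCount)) r r<p

      -r-square : square? (p ∸ r) ≡ true
      -r-square = forced r≢0 r-nonsquare at-r
        where
          forced : ∀ {a b c} → a ≡ true → b ≡ false → when (a ∧ b) 1 ≡ when (a ∧ not c) 1 → c ≡ true
          forced {c = true}  _    _    _  = refl
          forced {c = false} refl refl ()

  private
    sign-not : ∀ b → sign (not b) ≡ - sign b
    sign-not true  = refl
    sign-not false = refl

    χ-p-even : ∀ m → h ≡ m + m → χ p ≡ + 1
    χ-p-even m h≡even = trans (cong (λ k → χ (suc (k + k))) h≡even) (trans (cong χ (lemma m)) (χ-one m))
      where lemma : ∀ m → suc (m + m + (m + m)) ≡ 1 + m ℕ.* 4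
            lemma = ℕ-Solver.solve-∀

    χ-p-odd : ∀ m → h ≡ suc (m + m) → χ p ≡ - + 1
    χ-p-odd m h≡odd = trans (cong (λ k → χ (suc (k + k))) h≡odd) (trans (cong χ (lemma m)) (χ-three m))
      where lemma : ∀ m → suc (suc (m + m) + suc (m + m)) ≡ 3 + m ℕ.* 4
            lemma = ℕ-Solver.solve-∀

    isSqMod-neg-even : ∀ m → h ≡ m + m → ∀ x → isSqMod (- x) p ≡ isSqMod x p
    isSqMod-neg-even m h≡even x = ≡true⇔⇒≡
      (λ -x-square → isSqMod-complete x (IsSquare-neg⁻¹ (-1-square m h≡even) (isSqMod-sound (- x) -x-square)))
      (λ x-square → isSqMod-complete (- x) (IsSquare-neg (-1-square m h≡even) (isSqMod-sound x x-square)))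

    isSqMod-neg-odd : ∀ m → h ≡ suc (m + m) → ∀ {x} → IsUnit p x → isSqMod (- x) p ≡ not (isSqMod x p)
    isSqMod-neg-odd m h≡odd {x} x-unit with isSqMod x p in x-square | isSqMod (- x) p in -x-square
    ... | true  | false = refl
    ... | false | true  = refl
    ... | true  | true  = ⊥-elim (-1-nonsquare m h≡odd
                            (-1-square-from x-unit (isSqMod-sound x x-square) (isSqMod-sound (- x) -x-square)))
    ... | false | false = ⊥-elim (false≢true (trans (sym -x-square) (isSqMod-complete (- x)
                            (nonsquare-neg-square m h≡odd x-unit
                               (λ sq → false≢true (trans (sym x-square) (isSqMod-complete x sq)))))))

  legendre-neg : ∀ {x} → IsUnit p x → legendre (- x) p ≡ χ p * legendre x p
  legendre-neg {x} x-unit with even-or-odd h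
  ... | m , inj₁ h≡even = begin
    legendre (- x) p        ≡⟨ legendre-unit (IsUnit-neg {p} {x} x-unit) ⟩
    sign (isSqMod (- x) p)  ≡⟨ cong sign (isSqMod-neg-even m h≡even x) ⟩
    sign (isSqMod x p)      ≡⟨ legendre-unit x-unit ⟨
    legendre x p            ≡⟨ ℤ.*-identityˡ _ ⟨
    + 1 * legendre x p      ≡⟨ cong (_* legendre x p) (χ-p-even m h≡even) ⟨
    χ p * legendre x p      ∎
    where open ≡-Reasoning
  ... | m , inj₂ h≡odd = begin
    legendre (- x) p          ≡⟨ legendre-unit (IsUnit-neg {p} {x} x-unit) ⟩
    sign (isSqMod (- x) p)    ≡⟨ cong sign (isSqMod-neg-odd m h≡odd x-unit) ⟩
    sign (not (isSqMod x p))  ≡⟨ sign-not (isSqMod x p) ⟩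
    - sign (isSqMod x p)      ≡⟨ cong -_ (legendre-unit x-unit) ⟨
    - legendre x p            ≡⟨ ℤ.-1*i≡-i _ ⟨
    - + 1 * legendre x p      ≡⟨ cong (_* legendre x p) (χ-p-odd m h≡odd) ⟨
    χ p * legendre x p        ∎
    where open ≡-Reasoning

  legendre-square-factor : ∀ u a → IsUnit p u → legendre (u * u * a) p ≡ legendre a p
  legendre-square-factor u a (v , uv≡1) = cong₂ (λ z s → if z then + 0 else sign s) zero-same square-same
    where
      v²u²a≡a : v * v * (u * u * a) ≡ a [mod p ]
      v²u²a≡a = begin
        v * v * (u * u * a)        ≡⟨ lemma u v a ⟩
        (u * v) * (u * v) * a      ≈⟨ *-congʳ[mod] a (*-cong[mod] uv≡1 uv≡1) ⟩
        + 1 * + 1 * a              ≡⟨ ℤ.*-identityˡ a ⟩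
        a                          ∎
        where
          open ≡[mod]-Reasoning p
          lemma : ∀ u v a → v * v * (u * u * a) ≡ (u * v) * (u * v) * a
          lemma = solve-∀
      zero-same : (modℤ (u * u * a) p ≡ᵇ 0) ≡ (modℤ a p ≡ᵇ 0)
      zero-same = ≡true⇔⇒≡
        (λ u²a≡0 → ≡ᵇ-true (modℤ-cong (≡[mod]-trans (≡[mod]-sym v²u²a≡a)
          (≡[mod]-trans (*-congˡ[mod] (v * v) (modℤ-cong⁻¹ {u * u * a} {+ 0} (≡ᵇ-sound _ 0 u²a≡0)))
                        (≡[mod]-reflexive (ℤ.*-zeroʳ (v * v)))))))
        (λ a≡0 → ≡ᵇ-true (modℤ-cong (≡[mod]-trans (*-congˡ[mod] (u * u) (modℤ-cong⁻¹ {a} {+ 0} (≡ᵇ-sound _ 0 a≡0)))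
                                                (≡[mod]-reflexive (ℤ.*-zeroʳ (u * u))))))
      square-same : isSqMod (u * u * a) p ≡ isSqMod a p
      square-same = ≡true⇔⇒≡
        (λ sq → isSqMod-complete a (IsSquare-resp v²u²a≡a (IsSquare-* (square-isSquare v) (isSqMod-sound _ sq))))
        (λ sq → isSqMod-complete (u * u * a) (IsSquare-* (square-isSquare u) (isSqMod-sound a sq)))

module Jacobi where

  open import Data.Nat as ℕ using (ℕ; suc; _+_)
  import Data.Nat.Divisibility as ℕ
  open import Data.Nat.Primality using (Prime)
  open import Data.Nat.ListAction using (product)
  open import Data.Nat.Primality.Factorisation using (factorise; PrimeFactorisation)
  open import Data.Integer using (ℤ; +_; _*_; -_)
  open import Data.Integer.Tactic.RingSolver using (solve-∀)
  open import Data.List using (List; []; _∷_; foldr)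
  open import Data.List.Relation.Unary.All using (All; []; _∷_)
  open import Data.Product using (_,_)
  open import Relation.Binary.PropositionalEquality using (_≡_; refl; sym; trans; cong; cong₂; subst)
  open import Defs using (legendre; jacobi)
  open Parity using (divisor-of-odd)
  open Congruence using (_≡_[mod_]; ≡[mod]-divisor; IsUnit; IsUnit-divisor)
  open Mod4 using (χ; χ-*; odd⇒OddMod4)

  private
    variable
      p : ℕ

    legendre-cong : ∀ k → Prime p → p ℕ.∣ suc (k + k) → ∀ {x y} → x ≡ y [mod p ] → legendre x p ≡ legendre y p
    legendre-cong k p-prime p∣q with divisor-of-odd {k = k} p∣q
    ... | h , refl = Legendre.legendre-cong h p-prime

    legendre-square-factor : ∀ k → Prime p → p ℕ.∣ suc (k + k) → ∀ u a → IsUnit p u → legendre (u * u * a) p ≡ legendre a p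
    legendre-square-factor k p-prime p∣q with divisor-of-odd {k = k} p∣q
    ... | h , refl = Legendre.legendre-square-factor h p-prime

    legendre-neg : ∀ k → Prime p → p ℕ.∣ suc (k + k) → ∀ {x} → IsUnit p x → legendre (- x) p ≡ χ p * legendre x p
    legendre-neg k p-prime p∣q {x} with divisor-of-odd {k = k} p∣q
    ... | h , refl = Legendre.legendre-neg h p-prime {x}

    χ-multiplicative : ∀ k {a b} → a ℕ.∣ suc (k + k) → b ℕ.∣ suc (k + k) → χ (a ℕ.* b) ≡ χ a * χ b
    χ-multiplicative k a∣q b∣q with divisor-of-odd {k = k} a∣q | divisor-of-odd {k = k} b∣q
    ... | h , refl | h′ , refl = χ-* (odd⇒OddMod4 h) (odd⇒OddMod4 h′)

    legendre-product : ℤ → List ℕ → ℤ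
    legendre-product a = foldr (λ p r → legendre a p * r) (+ 1)

    head∣ : ∀ p ps {n} → product (p ∷ ps) ℕ.∣ n → p ℕ.∣ n
    head∣ p ps = ℕ.∣-trans (ℕ.m∣m*n (product ps))

    tail∣ : ∀ p ps {n} → product (p ∷ ps) ℕ.∣ n → product ps ℕ.∣ n
    tail∣ p ps = ℕ.∣-trans (ℕ.n∣m*n p)

    module Products (k : ℕ) where
      q : ℕ
      q = suc (k + k)

      product-cong : ∀ ps → All Prime ps → product ps ℕ.∣ q → ∀ {x y} → x ≡ y [mod q ] →
                     legendre-product x ps ≡ legendre-product y ps
      product-cong []       []                 _   _   = refl
      product-cong (p ∷ ps) (p-prime ∷ primes) ps∣q {x} {y} x≡y =
        cong₂ _*_ (legendre-cong k p-prime (head∣ p ps ps∣q) (≡[mod]-divisor {x} {y} (head∣ p ps ps∣q) x≡y))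
                  (product-cong ps primes (tail∣ p ps ps∣q) x≡y)

      product-square-factor : ∀ ps → All Prime ps → product ps ℕ.∣ q → ∀ u a → IsUnit q u →
                              legendre-product (u * u * a) ps ≡ legendre-product a ps
      product-square-factor []       []                 _   _ _ _ = refl
      product-square-factor (p ∷ ps) (p-prime ∷ primes) ps∣q u a u-unit =
        cong₂ _*_ (legendre-square-factor k p-prime (head∣ p ps ps∣q) u a (IsUnit-divisor {x = u} (head∣ p ps ps∣q) u-unit))
                  (product-square-factor ps primes (tail∣ p ps ps∣q) u a u-unit)

      product-neg : ∀ ps → All Prime ps → product ps ℕ.∣ q → ∀ {x} → IsUnit q x →
                    legendre-product (- x) ps ≡ χ (product ps) * legendre-product x ps
      product-neg []       []                 _   _ = refl
      product-neg (p ∷ ps) (p-prime ∷ primes) ps∣q {x} x-unit =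
        trans (cong₂ _*_ (legendre-neg k p-prime (head∣ p ps ps∣q) (IsUnit-divisor {x = x} (head∣ p ps ps∣q) x-unit))
                         (product-neg ps primes (tail∣ p ps ps∣q) x-unit))
              (trans (lemma (χ p) (legendre x p) (χ (product ps)) (legendre-product x ps))
                     (cong (_* (legendre x p * legendre-product x ps))
                           (sym (χ-multiplicative k (head∣ p ps ps∣q) (tail∣ p ps ps∣q)))))
        where lemma : ∀ a b c d → (a * b) * (c * d) ≡ (a * c) * (b * d)
              lemma = solve-∀

  module _ (k : ℕ) where
    private
      q : ℕ
      q = suc (k + k)
      factorisation = factorise q
      open PrimeFactorisation factorisation using (factors; factorsPrime; isFactorisation)
      factors∣q : product factors ℕ.∣ q
      factors∣q = subst (ℕ._∣ q) isFactorisation ℕ.∣-refl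

    jacobi-cong : ∀ {x y} → x ≡ y [mod q ] → jacobi x q ≡ jacobi y q
    jacobi-cong = Products.product-cong k factors factorsPrime factors∣q

    jacobi-square-factor : ∀ u a → IsUnit q u → jacobi (u * u * a) q ≡ jacobi a q
    jacobi-square-factor = Products.product-square-factor k factors factorsPrime factors∣q

    jacobi-neg : ∀ {x} → IsUnit q x → jacobi (- x) q ≡ χ q * jacobi x q
    jacobi-neg {x} x-unit = trans (Products.product-neg k factors factorsPrime factors∣q x-unit)
                                  (cong (λ n → χ n * jacobi x q) (sym isFactorisation))

module Halving where

  open import Data.Nat as ℕ using (ℕ; zero; suc; _+_; _≡ᵇ_; z≤n; s≤s)
  import Data.Nat.Properties as ℕ
  open import Data.Nat.Divisibility
    using (_∣_; divides; _∣?_; ∣-trans; ∣m∣n⇒∣m+n; ∣m+n∣m⇒∣n; ∣⇒≤; 0∣⇒≡0)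
  open import Data.Nat.Coprimality using (Coprime; coprime-divisor; coprime-+; gcd≡1⇒coprime; coprime⇒gcd≡1)
  open import Data.Nat.GCD using (gcd)
  open import Data.Bool using (Bool; true; false)
  open import Data.Bool.Properties using (¬-not)
  open import Data.Product using (_×_; _,_; proj₁; proj₂)
  open import Data.Sum using (_⊎_; inj₁; inj₂)
  open import Data.Empty using (⊥-elim)
  open import Function.Bundles using (_⇔_; mk⇔; Equivalence)
  open Equivalence using (to; from)
  open import Relation.Nullary using (¬_; yes; no)
  open import Relation.Binary.PropositionalEquality using (_≡_; refl; trans; subst)
  open Booleans using (≡true⇔⇒≡; ≡ᵇ-true; ≡ᵇ-sound)
  open Parity using (even-or-odd; 2∤odd; double≡2*)
  import Data.Nat.Tactic.RingSolver as ℕ-Solver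

  coprime? : ℕ → ℕ → Bool
  coprime? b n = gcd b n ≡ᵇ 1

  coprime?-sound : ∀ {b n} → coprime? b n ≡ true → Coprime b n
  coprime?-sound {b} {n} c = gcd≡1⇒coprime (≡ᵇ-sound (gcd b n) 1 c)

  coprime?-complete : ∀ {b n} → Coprime b n → coprime? b n ≡ true
  coprime?-complete c = ≡ᵇ-true (coprime⇒gcd≡1 c)

  private
    2∣double : ∀ q → 2 ∣ q + q
    2∣double q = divides q (trans (double≡2* q) (ℕ.*-comm 2 q))

    divisor-of-odd-coprime-2 : ∀ {i n} → ¬ 2 ∣ n → i ∣ n → Coprime i 2
    divisor-of-odd-coprime-2 {i} {n} 2∤n i∣n {d} (d∣i , d∣2) with ∣⇒≤ d∣2
    ... | s≤s z≤n       = refl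
    ... | s≤s (s≤s z≤n) = ⊥-elim (2∤n (∣-trans d∣i i∣n))
    divisor-of-odd-coprime-2 {i} {n} 2∤n i∣n {zero} (_ , 0∣2) | z≤n with () ← 0∣⇒≡0 0∣2

  coprime-double : ∀ {n q} → Coprime n (q + q) ⇔ (Coprime n q × ¬ 2 ∣ n)
  coprime-double {n} {q} = mk⇔
    (λ c → (λ {i} (i∣n , i∣q) → c (i∣n , ∣m∣n⇒∣m+n i∣q i∣q)) , (λ 2∣n → 2≢1 (c (2∣n , 2∣double q))))
    (λ (c , 2∤n) {i} (i∣n , i∣2q) → c (i∣n , coprime-divisor (divisor-of-odd-coprime-2 2∤n i∣n)
                                               (subst (i ∣_) (double≡2* q) i∣2q)))
    where 2≢1 : ¬ 2 ≡ 1
          2≢1 ()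

  coprime-shift : ∀ {b q} → Coprime (q + b) q ⇔ Coprime b q
  coprime-shift = mk⇔ (λ c {i} (i∣b , i∣q) → c (∣m∣n⇒∣m+n i∣q i∣b , i∣q)) coprime-+

  odd-shift-parity : ∀ k b → 2 ∣ suc (k + k) + b ⇔ (¬ 2 ∣ b)
  odd-shift-parity k b = mk⇔
    (λ 2∣q+b 2∣b → 2∤odd k (∣m+n∣n⇒∣m 2∣q+b 2∣b))
    (λ 2∤b → odd+odd b 2∤b)
    where
      ∣m+n∣n⇒∣m : ∀ {m n} → 2 ∣ m + n → 2 ∣ n → 2 ∣ m
      ∣m+n∣n⇒∣m {m} {n} 2∣m+n 2∣n = ∣m+n∣m⇒∣n (subst (2 ∣_) (ℕ.+-comm m n) 2∣m+n) 2∣n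
      odd+odd : ∀ b → ¬ 2 ∣ b → 2 ∣ suc (k + k) + b
      odd+odd b 2∤b with even-or-odd b
      ... | h , inj₁ refl = ⊥-elim (2∤b (2∣double h))
      ... | h , inj₂ refl = subst (2 ∣_) (lemma k h) (2∣double (suc (k + h)))
        where
          lemma : ∀ k h → suc (k + h) + suc (k + h) ≡ suc (k + k) + suc (h + h)
          lemma = ℕ-Solver.solve-∀

  module _ (k : ℕ) where
    private
      q : ℕ
      q = suc (k + k)

    exactly-one-lift-coprime : ∀ b →
      (coprime? b (q + q) ≡ coprime? b q × coprime? (q + b) (q + q) ≡ false) ⊎
      (coprime? b (q + q) ≡ false × coprime? (q + b) (q + q) ≡ coprime? b q)
    exactly-one-lift-coprime b with 2 ∣? b
    ... | no 2∤b = inj₁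
      ( ≡true⇔⇒≡ (λ c → coprime?-complete (proj₁ (to coprime-double (coprime?-sound {b} {q + q} c))))
                 (λ c → coprime?-complete (from (coprime-double {b} {q}) (coprime?-sound {b} {q} c , 2∤b)))
      , ¬-not (λ c → proj₂ (to (coprime-double {q + b} {q}) (coprime?-sound {q + b} {q + q} c))
                           (from (odd-shift-parity k b) 2∤b)))
    ... | yes 2∣b = inj₂
      ( ¬-not (λ c → proj₂ (to (coprime-double {b} {q}) (coprime?-sound {b} {q + q} c)) 2∣b)
      , ≡true⇔⇒≡ (λ c → coprime?-complete (to coprime-shift
                          (proj₁ (to (coprime-double {q + b} {q}) (coprime?-sound {q + b} {q + q} c)))))
                 (λ c → coprime?-complete (from (coprime-double {q + b} {q})
                          (from coprime-shift (coprime?-sound {b} {q} c) , λ 2∣q+b → to (odd-shift-parity k b) 2∣q+b 2∣b))))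

module ThetaSums {a ℓ} (R : CommutativeRing a ℓ) where

  open import Data.Nat as ℕ using (ℕ; zero; suc; _<_; _≡ᵇ_)
  open import Data.Nat.DivMod using (_%_)
  open import Data.Integer as ℤ using (ℤ; +_; -[1+_])
  import Data.Integer.Properties as ℤ
  open import Data.Integer.Tactic.RingSolver using (solve-∀)
  open import Data.Bool using (true; false)
  open import Data.Product using (_,_)
  open import Data.Sum using (inj₁; inj₂)
  import Relation.Binary.PropositionalEquality as P
  open P using (_≡_)
  open import Defs using (modℤ; invMod; jacobi; module Theta)
  open Congruence
  open Halving using (coprime?; coprime?-sound; coprime?-complete; exactly-one-lift-coprime)
  open Jacobi using (jacobi-cong; jacobi-square-factor; jacobi-neg)
  open Mod4 using (χ)

  open CommutativeRing R
  open Theta R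
  open FiniteSum +-commutativeMonoid
  open import Algebra.Properties.Ring ring using (-‿distribʳ-*; -0#≈0#; -‿involutive; -1*x≈-x)
  import Relation.Binary.Reasoning.Setoid setoid as ≈-Reasoning

  natR-1 : natR 1 ≈ 1#
  natR-1 = +-identityʳ 1#

  fromℤ-neg : ∀ z → fromℤ (ℤ.- z) ≈ - fromℤ z
  fromℤ-neg (+ zero)  = sym -0#≈0#
  fromℤ-neg (+ suc n) = refl
  fromℤ-neg -[1+ n ]  = sym (-‿involutive _)

  fromℤ-χ-* : ∀ n z → fromℤ (χ n ℤ.* z) ≈ fromℤ (χ n) * fromℤ z
  fromℤ-χ-* n z with n % 4 ≡ᵇ 1
  ... | true  = begin
    fromℤ (+ 1 ℤ.* z)   ≡⟨ P.cong fromℤ (ℤ.*-identityˡ z) ⟩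
    fromℤ z             ≈⟨ *-identityˡ _ ⟨
    1# * fromℤ z        ≈⟨ *-congʳ natR-1 ⟨
    natR 1 * fromℤ z    ∎
    where open ≈-Reasoning
  ... | false = begin
    fromℤ (ℤ.- + 1 ℤ.* z)  ≡⟨ P.cong fromℤ (ℤ.-1*i≡-i z) ⟩
    fromℤ (ℤ.- z)          ≈⟨ fromℤ-neg z ⟩
    - fromℤ z              ≈⟨ -1*x≈-x _ ⟨
    - 1# * fromℤ z         ≈⟨ *-congʳ (-‿cong natR-1) ⟨
    - natR 1 * fromℤ z     ∎
    where open ≈-Reasoning

  ε-χ : ∀ i ζ n → ε i ζ n * fromℤ (χ n) ≈ ε̄ i ζ n
  ε-χ i ζ n with n % 4 ≡ᵇ 1
  ... | true  = trans (*-identityˡ _) natR-1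
  ... | false = trans (*-congˡ (-‿cong natR-1)) (trans (sym (-‿distribʳ-* i 1#)) (-‿cong (*-identityʳ i)))

  when-*ˡ : ∀ b c x → when b (c * x) ≈ c * when b x
  when-*ˡ true  c x = refl
  when-*ˡ false c x = sym (zeroʳ c)

  ∑-*ˡ : ∀ n c f → ∑[ x < n ] (c * f x) ≈ c * ∑< n f
  ∑-*ˡ zero    c f = sym (zeroʳ c)
  ∑-*ˡ (suc n) c f = trans (+-congʳ (∑-*ˡ n c f)) (sym (distribˡ c _ _))

  sumCoprime-as-∑ : ∀ m f → sumCoprime m f ≈ ∑[ x < m ] when (coprime? x m) (f x)
  sumCoprime-as-∑ m f = foldr-upTo m (λ x → coprime? x m) f

  -- Θ₄ and Θ₅ with c₁ = c / 2 abstracted, so that c₁ can be rewritten independently of c.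
  Θ₄-with-half : Carrier → Carrier → ℤ → ℕ → ℕ → Carrier
  Θ₄-with-half i ζ n c c₁ = ε i ζ c₁ * sumCoprime c (λ a →
    fromℤ (jacobi (+ 8 ℤ.* + a) c₁) * e i ζ (ℤ.- (+ invMod (+ 8 ℤ.* + a) c₁) ℤ.* n) c₁)

  Θ₅-with-half : Carrier → Carrier → ℤ → ℕ → ℕ → Carrier
  Θ₅-with-half i ζ n c c₁ = ε̄ i ζ c₁ * sumCoprime c (λ a →
    fromℤ (jacobi (ℤ.- (+ 2) ℤ.* + invMod (+ a) c₁) c₁) * e i ζ (ℤ.- (+ invMod (+ 2 ℤ.* + a) c₁) ℤ.* n) c₁)

  module OddModulus (k : ℕ) where

    q : ℕ
    q = suc (k ℕ.+ k)

    lift-≡ : ∀ b → + (q ℕ.+ b) ≡ + b [mod q ]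
    lift-≡ b = ≡[mod]-trans (≡[mod]-reflexive (P.trans (ℤ.pos-+ q b) (lemma (+ q) (+ b))))
                            (+-multiple[mod] (+ b) (+ 1) q)
      where lemma : ∀ q b → q ℤ.+ b ≡ b ℤ.+ + 1 ℤ.* q
            lemma = solve-∀

    -- Of b and q + b exactly one is odd, and only that one is coprime to 2q.
    sumCoprime-double : ∀ F → (∀ b → F (q ℕ.+ b) ≡ F b) →
                        sumCoprime (q ℕ.+ q) F ≈ ∑[ b < q ] when (coprime? b q) (F b)
    sumCoprime-double F periodic = begin
      sumCoprime (q ℕ.+ q) F
        ≈⟨ sumCoprime-as-∑ (q ℕ.+ q) F ⟩
      ∑[ x < q ℕ.+ q ] when (coprime? x (q ℕ.+ q)) (F x)
        ≈⟨ ∑-split q q _ ⟩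
      ∑[ b < q ] when (coprime? b (q ℕ.+ q)) (F b) + ∑[ b < q ] when (coprime? (q ℕ.+ b) (q ℕ.+ q)) (F (q ℕ.+ b))
        ≈⟨ ∑-distrib q _ _ ⟨
      ∑[ b < q ] (when (coprime? b (q ℕ.+ q)) (F b) + when (coprime? (q ℕ.+ b) (q ℕ.+ q)) (F (q ℕ.+ b)))
        ≈⟨ ∑-cong q (λ b _ → one-lift b) ⟩
      ∑[ b < q ] when (coprime? b q) (F b)
        ∎
      where
        open ≈-Reasoning
        one-lift : ∀ b → when (coprime? b (q ℕ.+ q)) (F b) + when (coprime? (q ℕ.+ b) (q ℕ.+ q)) (F (q ℕ.+ b))
                         ≈ when (coprime? b q) (F b)
        one-lift b rewrite periodic b with exactly-one-lift-coprime k b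
        ... | inj₁ (lower , upper) rewrite lower | upper = +-identityʳ _
        ... | inj₂ (lower , upper) rewrite lower | upper = +-identityˡ _

    ∑-coprime-reindex : ∀ φ (G H : ℕ → Carrier) → IsInvolutionOn q (λ b → coprime? b q) φ →
      (∀ b → b < q → coprime? b q ≡ true → G b ≈ H (φ b)) →
      ∑[ b < q ] when (coprime? b q) (G b) ≈ ∑[ b < q ] when (coprime? b q) (H b)
    ∑-coprime-reindex φ G H involution G≈Hφ =
      trans (∑-cong q pointwise) (∑-involution q (λ b → coprime? b q) φ H involution)
      where
        pointwise : ∀ b → b < q → when (coprime? b q) (G b) ≈ when (coprime? b q) (H (φ b))
        pointwise b b<q with coprime? b q in coprime
        ... | true  = G≈Hφ b b<q coprime
        ... | false = refl

    module NegatedInverse (c : ℕ) (c-unit : IsUnit q (+ c)) where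

      inv : ℕ → ℤ
      inv b = + invMod (+ c ℤ.* + b) q

      φ : ℕ → ℕ
      φ b = modℤ (ℤ.- inv b) q

      φ-≡ : ∀ b → + φ b ≡ ℤ.- inv b [mod q ]
      φ-≡ b = modℤ-≡[mod] (ℤ.- inv b) (k ℕ.+ k)

      b-unit : ∀ b → coprime? b q ≡ true → IsUnit q (+ b)
      b-unit b coprime = coprime⇒IsUnit (coprime?-sound {b} {q} coprime)

      inv-inverse : ∀ b → coprime? b q ≡ true → (+ c ℤ.* + b) ℤ.* inv b ≡ + 1 [mod q ]
      inv-inverse b coprime = invMod-inverse {+ c ℤ.* + b} {k ℕ.+ k} (IsUnit-* {q} {+ c} {+ b} c-unit (b-unit b coprime))

      φ-spec : ∀ b → coprime? b q ≡ true → (+ c ℤ.* + b) ℤ.* ℤ.- + φ b ≡ + 1 [mod q ]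
      φ-spec b coprime = begin
        (+ c ℤ.* + b) ℤ.* ℤ.- + φ b        ≈⟨ *-congˡ[mod] (+ c ℤ.* + b) (-‿cong[mod] (φ-≡ b)) ⟩
        (+ c ℤ.* + b) ℤ.* ℤ.- ℤ.- inv b    ≡⟨ P.cong ((+ c ℤ.* + b) ℤ.*_) (ℤ.neg-involutive (inv b)) ⟩
        (+ c ℤ.* + b) ℤ.* inv b            ≈⟨ inv-inverse b coprime ⟩
        + 1                                ∎
        where open ≡[mod]-Reasoning q

      φ-coprime : ∀ b → coprime? b q ≡ true → coprime? (φ b) q ≡ true
      φ-coprime b coprime = coprime?-complete (IsUnit⇒coprime {φ b} {q}
        (IsUnit-resp (≡[mod]-reflexive (ℤ.neg-involutive (+ φ b)))
                     (IsUnit-neg {q} {ℤ.- + φ b} (IsUnit-inverse {q} {+ c ℤ.* + b} (φ-spec b coprime)))))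

      involution : IsInvolutionOn q (λ b → coprime? b q) φ
      involution = record
        { <-closed   = λ b _ _ → modℤ-< (ℤ.- inv b) (k ℕ.+ k)
        ; U-closed   = λ b _ → φ-coprime b
        ; involutive = λ b b<q coprime → residues-unique (modℤ-< (ℤ.- inv (φ b)) (k ℕ.+ k)) b<q (begin
            + φ (φ b)           ≈⟨ φ-≡ (φ b) ⟩
            ℤ.- inv (φ b)       ≈⟨ -‿cong[mod] (inverse-unique {q} {+ c ℤ.* + φ b} {inv (φ b)} {ℤ.- + b}
                                     (inv-inverse (φ b) (φ-coprime b coprime)) (swap b coprime)) ⟩
            ℤ.- ℤ.- + b         ≡⟨ ℤ.neg-involutive (+ b) ⟩
            + b                 ∎)
        }
        where
          open ≡[mod]-Reasoning q
          swap : ∀ b → coprime? b q ≡ true → (+ c ℤ.* + φ b) ℤ.* ℤ.- + b ≡ + 1 [mod q ]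
          swap b coprime = ≡[mod]-trans (≡[mod]-reflexive (lemma (+ c) (+ b) (+ φ b))) (φ-spec b coprime)
            where lemma : ∀ c b t → (c ℤ.* t) ℤ.* ℤ.- b ≡ (c ℤ.* b) ℤ.* ℤ.- t
                  lemma = solve-∀

    8-isUnit : IsUnit q (+ 8)
    8-isUnit = IsUnit-* {q} {+ 4} {+ 2} (IsUnit-* {q} {+ 2} {+ 2} (2-isUnit-odd k) (2-isUnit-odd k)) (2-isUnit-odd k)

    module _ (i ζ : Carrier) (n : ℤ) where

      E : ℤ → Carrier
      E x = e i ζ x q

      E-cong : ∀ {x y} → x ≡ y [mod q ] → E x ≡ E y
      E-cong {x} {y} x≡y = P.cong (pow ζ) (modℤ-cong {x} {y} {k ℕ.+ k} x≡y)

      term : ℕ → Carrier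
      term t = fromℤ (jacobi (+ t) q) * E (+ t ℤ.* n)

      S : Carrier
      S = ∑[ t < q ] when (coprime? t q) (term t)

      Θ₁-as-∑ : Θ₁ i ζ q n ≈ ε̄ i ζ q * S
      Θ₁-as-∑ = *-congˡ (sumCoprime-as-∑ q _)

      module N₂ = NegatedInverse 2 (2-isUnit-odd k)
      module N₈ = NegatedInverse 8 8-isUnit

      term₅ : ℕ → Carrier
      term₅ a = fromℤ (jacobi (ℤ.- (+ 2) ℤ.* + invMod (+ a) q) q) * E (ℤ.- (+ invMod (+ 2 ℤ.* + a) q) ℤ.* n)

      term₅-periodic : ∀ b → term₅ (q ℕ.+ b) ≡ term₅ b
      term₅-periodic b = P.cong₂ (λ u v → fromℤ (jacobi (ℤ.- (+ 2) ℤ.* + u) q) * E (ℤ.- (+ v) ℤ.* n))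
        (invMod-cong {+ (q ℕ.+ b)} {+ b} {q} (lift-≡ b))
        (invMod-cong {+ 2 ℤ.* + (q ℕ.+ b)} {+ 2 ℤ.* + b} {q} (*-congˡ[mod] (+ 2) (lift-≡ b)))

      E-φ : ∀ c (c-unit : IsUnit q (+ c)) b →
            E (ℤ.- (+ invMod (+ c ℤ.* + b) q) ℤ.* n) ≡ E (+ NegatedInverse.φ c c-unit b ℤ.* n)
      E-φ c c-unit b = E-cong (*-congʳ[mod] n (≡[mod]-sym (NegatedInverse.φ-≡ c c-unit b)))

      -- b⁻¹ ≡ -2φ(b), so -2 b⁻¹ ≡ 2² φ(b).
      term₅-reindexed : ∀ b → b < q → coprime? b q ≡ true → term₅ b ≈ term (N₂.φ b)
      term₅-reindexed b _ coprime = reflexive (P.cong₂ (λ u v → fromℤ u * v) jacobi≡ (E-φ 2 (2-isUnit-odd k) b))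
        where
          t = + N₂.φ b
          b⁻¹ = + invMod (+ b) q
          b⁻¹≡-2t : b⁻¹ ≡ + 2 ℤ.* ℤ.- t [mod q ]
          b⁻¹≡-2t = inverse-unique {q} {+ b}
            (invMod-inverse {+ b} {k ℕ.+ k} (N₂.b-unit b coprime))
            (≡[mod]-trans (≡[mod]-reflexive (lemma (+ b) t)) (N₂.φ-spec b coprime))
            where lemma : ∀ b t → b ℤ.* (+ 2 ℤ.* ℤ.- t) ≡ (+ 2 ℤ.* b) ℤ.* ℤ.- t
                  lemma = solve-∀
          -2b⁻¹≡4t : ℤ.- (+ 2) ℤ.* b⁻¹ ≡ + 2 ℤ.* + 2 ℤ.* t [mod q ]
          -2b⁻¹≡4t = ≡[mod]-trans (*-congˡ[mod] (ℤ.- + 2) b⁻¹≡-2t) (≡[mod]-reflexive (lemma t))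
            where lemma : ∀ t → ℤ.- (+ 2) ℤ.* (+ 2 ℤ.* ℤ.- t) ≡ + 2 ℤ.* + 2 ℤ.* t
                  lemma = solve-∀
          jacobi≡ : jacobi (ℤ.- (+ 2) ℤ.* b⁻¹) q ≡ jacobi t q
          jacobi≡ = P.trans (jacobi-cong k -2b⁻¹≡4t) (jacobi-square-factor k (+ 2) t (2-isUnit-odd k))

      Θ₅-as-∑ : Θ₅-with-half i ζ n (q ℕ.+ q) q ≈ ε̄ i ζ q * S
      Θ₅-as-∑ = *-congˡ (trans (sumCoprime-double term₅ term₅-periodic)
                               (∑-coprime-reindex N₂.φ term₅ term N₂.involution term₅-reindexed))

      term₄ : ℕ → Carrier
      term₄ a = fromℤ (jacobi (+ 8 ℤ.* + a) q) * E (ℤ.- (+ invMod (+ 8 ℤ.* + a) q) ℤ.* n)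

      term₄-periodic : ∀ b → term₄ (q ℕ.+ b) ≡ term₄ b
      term₄-periodic b = P.cong₂ (λ u v → fromℤ u * E (ℤ.- (+ v) ℤ.* n))
        (jacobi-cong k (*-congˡ[mod] (+ 8) (lift-≡ b)))
        (invMod-cong {+ 8 ℤ.* + (q ℕ.+ b)} {+ 8 ℤ.* + b} {q} (*-congˡ[mod] (+ 8) (lift-≡ b)))

      -- With t = φ(b): 8b ≡ -t⁻¹ and t⁻¹ ≡ t⁻² t, so (8b/q) = χ(q) (t/q).
      term₄-reindexed : ∀ b → b < q → coprime? b q ≡ true → term₄ b ≈ fromℤ (χ q) * term (N₈.φ b)
      term₄-reindexed b _ coprime = begin
        fromℤ (jacobi (+ 8 ℤ.* + b) q) * E (ℤ.- (+ invMod (+ 8 ℤ.* + b) q) ℤ.* n)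
          ≡⟨ P.cong₂ (λ u v → fromℤ u * v) jacobi≡ (E-φ 8 8-isUnit b) ⟩
        fromℤ (χ q ℤ.* jacobi t q) * E (t ℤ.* n)
          ≈⟨ *-congʳ (fromℤ-χ-* q (jacobi t q)) ⟩
        fromℤ (χ q) * fromℤ (jacobi t q) * E (t ℤ.* n)
          ≈⟨ *-assoc _ _ _ ⟩
        fromℤ (χ q) * term (N₈.φ b)
          ∎
        where
          open ≈-Reasoning
          t = + N₈.φ b
          t⁻¹ = + invMod t q
          t-unit : IsUnit q t
          t-unit = coprime⇒IsUnit (coprime?-sound {N₈.φ b} {q} (N₈.φ-coprime b coprime))
          tt⁻¹≡1 : t ℤ.* t⁻¹ ≡ + 1 [mod q ]
          tt⁻¹≡1 = invMod-inverse {t} {k ℕ.+ k} t-unit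
          t⁻¹≡-8b : t⁻¹ ≡ ℤ.- (+ 8 ℤ.* + b) [mod q ]
          t⁻¹≡-8b = inverse-unique {q} {t} tt⁻¹≡1
            (≡[mod]-trans (≡[mod]-reflexive (lemma t (+ 8 ℤ.* + b))) (N₈.φ-spec b coprime))
            where lemma : ∀ t x → t ℤ.* ℤ.- x ≡ x ℤ.* ℤ.- t
                  lemma = solve-∀
          8b≡-t⁻¹ : + 8 ℤ.* + b ≡ ℤ.- t⁻¹ [mod q ]
          8b≡-t⁻¹ = ≡[mod]-trans (≡[mod]-reflexive (P.sym (ℤ.neg-involutive _))) (-‿cong[mod] (≡[mod]-sym t⁻¹≡-8b))
          t⁻²t≡t⁻¹ : t⁻¹ ℤ.* t⁻¹ ℤ.* t ≡ t⁻¹ [mod q ]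
          t⁻²t≡t⁻¹ = ≡[mod]-trans (≡[mod]-reflexive (lemma t⁻¹ t))
                       (≡[mod]-trans (*-congˡ[mod] t⁻¹ tt⁻¹≡1) (≡[mod]-reflexive (ℤ.*-identityʳ t⁻¹)))
            where lemma : ∀ u t → u ℤ.* u ℤ.* t ≡ u ℤ.* (t ℤ.* u)
                  lemma = solve-∀
          jacobi≡ : jacobi (+ 8 ℤ.* + b) q ≡ χ q ℤ.* jacobi t q
          jacobi≡ = P.trans (jacobi-cong k 8b≡-t⁻¹)
                   (P.trans (jacobi-neg k (IsUnit-inverse {q} {t} tt⁻¹≡1))
                   (P.cong (χ q ℤ.*_) (P.trans (jacobi-cong k (≡[mod]-sym t⁻²t≡t⁻¹))
                                               (jacobi-square-factor k t⁻¹ t (IsUnit-inverse {q} {t} tt⁻¹≡1)))))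

      Θ₄-as-∑ : Θ₄-with-half i ζ n (q ℕ.+ q) q ≈ ε̄ i ζ q * S
      Θ₄-as-∑ = begin
        ε i ζ q * sumCoprime (q ℕ.+ q) term₄
          ≈⟨ *-congˡ (sumCoprime-double term₄ term₄-periodic) ⟩
        ε i ζ q * ∑[ b < q ] when (coprime? b q) (term₄ b)
          ≈⟨ *-congˡ (∑-coprime-reindex N₈.φ term₄ (λ t → fromℤ (χ q) * term t) N₈.involution term₄-reindexed) ⟩
        ε i ζ q * ∑[ t < q ] when (coprime? t q) (fromℤ (χ q) * term t)
          ≈⟨ *-congˡ (trans (∑-cong q (λ t _ → when-*ˡ (coprime? t q) _ _)) (∑-*ˡ q _ _)) ⟩
        ε i ζ q * (fromℤ (χ q) * S)
          ≈⟨ *-assoc _ _ _ ⟨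
        ε i ζ q * fromℤ (χ q) * S
          ≈⟨ *-congʳ (ε-χ i ζ q) ⟩
        ε̄ i ζ q * S
          ∎
        where open ≈-Reasoning

private
  twice-odd : ∀ {c} → c % 4 ≡ 2 → c ≡ Nat.suc (c / 4 Nat.+ c / 4) Nat.+ Nat.suc (c / 4 Nat.+ c / 4)
  twice-odd {c} c%4≡2 = P.trans (m≡m%n+[m/n]*n c 4) (P.trans (P.cong (Nat._+ c / 4 Nat.* 4) c%4≡2) (lemma (c / 4)))
    where lemma : ∀ k → 2 Nat.+ k Nat.* 4 ≡ Nat.suc (k Nat.+ k) Nat.+ Nat.suc (k Nat.+ k)
          lemma = Nat-Solver.solve-∀

  half-double : ∀ q → (q Nat.+ q) / 2 ≡ q
  half-double q = P.trans (P.cong (_/ 2) (P.trans (P.cong (q Nat.+_) (P.sym (Nat.+-identityʳ q))) (Nat.*-comm 2 q))) (m*n/n≡m q 2)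

lemma3p4 : {a ℓ : Level} (R : CommutativeRing a ℓ)
    (i ζ : CommutativeRing.Carrier R) →
    CommutativeRing._≈_ R (CommutativeRing._*_ R i i) (CommutativeRing.-_ R (CommutativeRing.1# R)) →
    (c : ℕ) → c % 4 ≡ 2 →
    CommutativeRing._≈_ R (Theta.pow R ζ (c / 2)) (CommutativeRing.1# R) →
    (n : ℤ) →
    CommutativeRing._≈_ R (Theta.Θ₄ R i ζ c n) (Theta.Θ₅ R i ζ c n)
    × CommutativeRing._≈_ R (Theta.Θ₅ R i ζ c n) (Theta.Θ₁ R i ζ (c / 2) n)
lemma3p4 R i ζ _ c c%4≡2 _ n = trans Θ₄≈Θ₁ (sym Θ₅≈Θ₁) , Θ₅≈Θ₁
  where
    open CommutativeRing R
    open Theta R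
    open ThetaSums R
    open OddModulus (c / 4)
    c≡q+q = twice-odd c%4≡2
    c/2≡q : c / 2 ≡ q
    c/2≡q = P.trans (P.cong (_/ 2) c≡q+q) (half-double q)
    S≈Θ₁ : ε̄ i ζ q * S i ζ n ≈ Θ₁ i ζ (c / 2) n
    S≈Θ₁ = trans (sym (Θ₁-as-∑ i ζ n)) (reflexive (P.cong (λ m → Θ₁ i ζ m n) (P.sym c/2≡q)))
    Θ₄≈Θ₁ : Θ₄ i ζ c n ≈ Θ₁ i ζ (c / 2) n
    Θ₄≈Θ₁ = trans (reflexive (P.cong₂ (Θ₄-with-half i ζ n) {c} {q Nat.+ q} {c / 2} {q} c≡q+q c/2≡q))
                  (trans (Θ₄-as-∑ i ζ n) S≈Θ₁)
    Θ₅≈Θ₁ : Θ₅ i ζ c n ≈ Θ₁ i ζ (c / 2) n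
    Θ₅≈Θ₁ = trans (reflexive (P.cong₂ (Θ₅-with-half i ζ n) {c} {q Nat.+ q} {c / 2} {q} c≡q+q c/2≡q))
                  (trans (Θ₅-as-∑ i ζ n) S≈Θ₁)
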